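{- Let $\mathbb{M}$ be a simple matroid of rank $r+1$ on $E=\{0,\dots,n\}$ and $0\le k\le r$. Then \[ \mu^k=\deg\big(\alpha^{r-k}\cup(\mathrm{Crem}^*\alpha)^k\cup\Delta_\mathbb{M}\big) \] in the Chow cohomology of $X(\Delta_{\mathbb{U}_n})$.
   Context: $r(\cdot)$ is the rank function of $\mathbb{M}$; simple means no loops and no parallel pairs. $\chi_\mathbb{M}(q)=\sum_F\mu(\hat0,F)q^{r+1-r(F)}$ (sum over flats, $\mu$ the Möbius function of the lattice of flats) and $\mu^0,\dots,\mu^r$ are defined by $\chi_\mathbb{M}(q)/(q-1)=\sum_{i=0}^r(-1)^i\mu^iq^{r-i}$. $N=\mathbb{Z}^E/\langle e_0+\cdots+e_n\rangle\cong\mathbb{Z}^n$ with coordinates in which $e_1,\dots,e_n$ are the standard basis and $e_0=(-1,\dots,-1)$; $e_I=\sum_{i\in I}e_i$. The matroid fan $\Delta_\mathbb{M}$ is the fan in $N_\mathbb{R}$ with cones $\mathrm{cone}(e_{F_1},\dots,e_{F_j})$ for chains $\emptyset\subsetneq F_1\subsetneq\cdots\subsetneq F_j\subsetneq E$ of flats of $\mathbb{M}$; it is pure of dimension $r$. $\mathbb{U}_n$ is the uniform matroid of rank $n+1$ on $E$; $\Delta_{\mathbb{U}_n}$ is complete, unimodular, contains $\Delta_\mathbb{M}$ as a subfan and is invariant under $-1$; $X(\Delta_{\mathbb{U}_n})$ is the smooth complete toric variety, and $\mathrm{Crem}$ is its automorphism induced by $-1$ on $N$ (extending $(z_i)\mapsto(z_i^{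 -1})$ on $\mathbb{P}^n$). By Fulton–Sturmfels, $A^c(X)$ is the group of Minkowski weights of codimension $c$ on $\Delta_{\mathbb{U}_n}$ (functions $w$ on codimension-$c$ cones with $\sum_{\sigma\supset\tau}w(\sigma)v_{\sigma/\tau}=0$ in $N/N_\tau$ for each codimension-$(c+1)$ cone $\tau$), a class $d$ corresponding to $\sigma\mapsto\deg(d\cap[V(\sigma)])$. $\Delta_\mathbb{M}$ denotes the weight $1$ on the $r$-dimensional cones of $\Delta_\mathbb{M}$ and $0$ on other $r$-dimensional cones. $\alpha=\min\{0,x_1,\dots,x_n\}$, a piecewise linear function linear on each cone of $\Delta_{\mathbb{U}_n}$, regarded as the class in $A^1(X)$ of its associated $T$-equivariant line bundle (the pullback of $\mathcal{O}(1)$ along the blowdown $X\to\mathbb{P}^n$); $\mathrm{Crem}^*\alpha$ is its pullback under $\mathrm{Crem}$, i.e. the function $x\mapsto\alpha(-x)$. $\deg$ of a class in $A^n(X)$ is its value on the zero cone. -}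

module Defs where

open import Data.Bool using (Bool; true; false; if_then_else_; _∧_; _∨_; not; T)
open import Data.Nat as ℕ using (ℕ; zero; suc; _∸_; _≡ᵇ_)
open import Data.Integer as ℤ using (ℤ; _+_; _*_; _-_; -_; _⊓_; _^_; 0ℤ; 1ℤ; -1ℤ)
open import Data.Fin using (Fin; zero; suc)
open import Data.Fin.Subset using (Subset; ⊥; ⊤; ⁅_⁆; _∪_; _∩_; _⊆_; ∣_∣; inside; outside)
open import Data.Fin.Subset.Properties using (_⊆?_; _⊂?_)
open import Data.Vec using (Vec; []; _∷_; lookup)
open import Data.List using (List; []; _∷_; map; foldr; allFin; length)
import Data.List as L
open import Relation.Nullary using (does; ¬_)
open import Relation.Binary.PropositionalEquality using (_≡_)
import Data.Nat.Properties as ℕP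

allB : {A : Set} → (A → Bool) → List A → Bool
allB p = foldr (λ a b → p a ∧ b) true

sumℤ : List ℤ → ℤ
sumℤ = foldr _+_ 0ℤ

ΣFin : (m : ℕ) → (Fin m → ℤ) → ℤ
ΣFin m f = sumℤ (map f (allFin m))

Σupto : (r : ℕ) → (ℕ → ℤ) → ℤ
Σupto zero    f = f zero
Σupto (suc r) f = Σupto r f + f (suc r)

allSubsets : (m : ℕ) → List (Subset m)
allSubsets zero    = [] ∷ []
allSubsets (suc m) = map (outside ∷_) (allSubsets m) L.++ map (inside ∷_) (allSubsets m)

ΣSub : (m : ℕ) → (Subset m → ℤ) → ℤ
ΣSub m f = sumℤ (map f (allSubsets m))

record Matroid (m : ℕ) : Set where
  field
    rk          : Subset m → ℕ
    rk-bounded  : ∀ A → rk A ℕ.≤ ∣ A ∣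
    rk-mono     : ∀ A B → A ⊆ B → rk A ℕ.≤ rk B
    rk-submod   : ∀ A B → rk (A ∪ B) ℕ.+ rk (A ∩ B) ℕ.≤ rk A ℕ.+ rk B
open Matroid public

record Simple {m : ℕ} (M : Matroid m) : Set where
  field
    noLoops    : ∀ i → rk M ⁅ i ⁆ ≡ 1
    noParallel : ∀ i j → ¬ (i ≡ j) → rk M (⁅ i ⁆ ∪ ⁅ j ⁆) ≡ 2

rank : {m : ℕ} → Matroid m → ℕ
rank M = rk M ⊤

isFlat : {m : ℕ} → Matroid m → Subset m → Bool
isFlat {m} M F = allB (λ x → lookup F x ∨ not (rk M (F ∪ ⁅ x ⁆) ≡ᵇ rk M F)) (allFin m)

-- Möbius function μ(0̂, -) on the lattice of flats.  M loopless, so 0̂ = ∅.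
-- Defining property: μ(0̂,0̂) = 1 and Σ_{0̂ ≤ G ≤ F} μ(0̂,G) = 0 for flats F ≠ 0̂.
record IsMobius {m : ℕ} (M : Matroid m) (μ : Subset m → ℤ) : Set where
  field
    mob-bot  : μ ⊥ ≡ 1ℤ
    mob-rec  : ∀ F → T (isFlat M F) → ¬ (F ≡ ⊥) →
               ΣSub m (λ G → if isFlat M G ∧ does (G ⊆? F) then μ G else 0ℤ) ≡ 0ℤ

χ : {m : ℕ} → Matroid m → (Subset m → ℤ) → ℤ → ℤ
χ {m} M μ q = ΣSub m (λ F → if isFlat M F then μ F * q ^ (rank M ∸ rk M F) else 0ℤ)

IsReducedCoeffs : {m : ℕ} → Matroid m → (Subset m → ℤ) → (r : ℕ) → (ℕ → ℤ) → Set
IsReducedCoeffs M μ r mu =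
  ∀ (q : ℤ) → χ M μ q ≡ (q - 1ℤ) * Σupto r (λ i → (-1ℤ ^ i) * mu i * q ^ (r ∸ i))

-- The fan Δ_{U_n}, with E = Fin (suc n).
-- N = ℤ^E / ⟨e_0+…+e_n⟩; we work with representatives in ℤ^E.
-- Cones are chains ∅ ⊊ S₁ ⊊ … ⊊ S_j ⊊ E, stored as increasing lists.

Vecℤ : ℕ → Set
Vecℤ m = Fin m → ℤ

eS : {m : ℕ} → Subset m → Vecℤ m
eS S x = if lookup S x then 1ℤ else 0ℤ

nonemptyProper : {m : ℕ} → Subset m → Bool
nonemptyProper {m} S = not (does (S ⊆? ⊥)) ∧ not (does (⊤ ⊆? S))

isChain : {m : ℕ} → List (Subset m) → Bool
isChain []           = true
isChain (S ∷ [])     = nonemptyProper S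
isChain (S ∷ T ∷ τ)  = nonemptyProper S ∧ does (S ⊂? T) ∧ isChain (T ∷ τ)

-- the list of τ ∪ {S} (sorted, if it is a chain)
insertS : {m : ℕ} → Subset m → List (Subset m) → List (Subset m)
insertS S []      = S ∷ []
insertS S (T ∷ τ) = if does (S ⊆? T) then S ∷ T ∷ τ else T ∷ insertS S τ

-- Minkowski weights: integer functions on cones (= chains)
Weight : ℕ → Set
Weight m = List (Subset m) → ℤ

-- piecewise linear functions on N, as functions on representatives in ℤ^E
PL : ℕ → Set
PL m = Vecℤ m → ℤ

-- α = min{0,x₁,…,xₙ}; in ℤ^E coordinates x_i = y_i - y_0, so α(y) = min_i y_i - y_0
α : {n : ℕ} → PL (suc n)
α {n} y = foldr (λ i acc → y i ⊓ acc) (y zero) (allFin (suc n)) - y zero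

cremα : {n : ℕ} → PL (suc n)
cremα y = α (λ i → - y i)

wExt : {m : ℕ} → Weight m → List (Subset m) → Subset m → ℤ
wExt w τ S = if isChain (insertS S τ) then w (insertS S τ) else 0ℤ

-- Σ_{σ ⊃ τ} w(σ) v_{σ/τ}  (representative in ℤ^E)
balSum : {m : ℕ} → Weight m → List (Subset m) → Vecℤ m
balSum {m} w τ x = ΣSub m (λ S → wExt w τ S * eS S x)

-- w' = φ · w  (the cap product c₁(L_φ) ∩ w in Minkowski weight terms):
--   w'(τ) = φ_τ(Σ_{σ⊃τ} w(σ) v_{σ/τ}) - Σ_{σ⊃τ} w(σ) φ(v_{σ/τ}),
-- where φ_τ is the linear extension of φ|τ to span(τ): if the vector is
-- Σ_i c_i e_{S_i} (mod e_E) then φ_τ of it is Σ_i c_i φ(e_{S_i}).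
IsProduct : {m : ℕ} → PL m → Weight m → Weight m → Set
IsProduct {m} φ w w' =
  ∀ (τ : List (Subset m)) → T (isChain τ) →
  ∀ (c : Fin (length τ) → ℤ) (t : ℤ) →
  (∀ x → balSum w τ x ≡ ΣFin (length τ) (λ i → c i * eS (L.lookup τ i) x) + t) →
  w' τ ≡ ΣFin (length τ) (λ i → c i * φ (eS (L.lookup τ i)))
         - ΣSub m (λ S → wExt w τ S * φ (eS S))

ΔM : {m : ℕ} → Matroid m → (r : ℕ) → Weight m
ΔM M r τ = if isChain τ ∧ (length τ ≡ᵇ r) ∧ allB (isFlat M) τ then 1ℤ else 0ℤ

module Submission where

-- Write ω(F) = (-1)^{rk F} μ(F), and call F₁ ⊊ ⋯ ⊊ F_j a flag from lo to hi if the Fᵢ are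
-- flats with rk Fᵢ = lo + i and lo + j = hi.  Capping Δ_M with i factors Crem*α and then j
-- factors α gives the Minkowski weight which is ω(F₁) on the flags from i to r - j and 0 on
-- every other cone.  Capping with Crem*α raises the bottom rank: the value on a flag with
-- bottom F becomes the sum of ω(G) over the hyperplanes G of F missing a fixed point of F,
-- which is ω(F) by Weisner's theorem.  Capping with α lowers the top rank, because above a
-- flat and through a point outside it lies exactly one flat of the next rank.  On the zero
-- cone the last weight is (-1)^k (w₀ + ⋯ + w_k), with w_d = Σ_{rk F = d} μ(F) the Whitney
-- numbers, and comparing coefficients in χ_M(q) = (q - 1) Σᵢ (-1)^i μ^i q^{r-i} identifies
-- this with μ^k.

open import Defs
open import Data.Bool using (Bool; true; false; if_then_else_; _∧_; _∨_; not; T)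
import Data.Bool.Properties as BoolP
open import Data.Unit using (⊤; tt)
open import Data.Empty renaming (⊥ to Empty) using (⊥-elim)
open import Data.Product using (_×_; _,_; proj₁; proj₂; ∃; Σ)
open import Data.Sum using (_⊎_; inj₁; inj₂)
open import Data.Nat as ℕ using (ℕ; zero; suc; _∸_; _≤_; _<_; z≤n; s≤s; _≡ᵇ_; _≤ᵇ_)
import Data.Nat.Properties as ℕP
open import Data.Integer as ℤ using (ℤ; _+_; _*_; _-_; -_; 0ℤ; 1ℤ; -1ℤ; _^_; _⊓_)
import Data.Integer.Properties as ℤP
open import Data.Integer.Tactic.RingSolver using (solve-∀)
open import Data.List as L using (List; []; _∷_; map; _++_; allFin; length)
import Data.List.Properties as ListP
import Data.List.Membership.Propositional as LM
open import Data.List.Membership.Propositional.Properties using (∈-allFin; ∈-lookup)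
open import Data.List.Relation.Unary.Any using (here; there)
open import Data.Vec using ([]; _∷_; lookup; tabulate)
import Data.Vec.Properties as VecP
open VecP using (lookup⇒[]=; []=⇒lookup; lookup∘tabulate)
open import Data.Fin using (Fin; zero; suc)
import Data.Fin.Properties as FinP
open import Data.Fin.Subset as Sub using (Subset; inside; outside; _∈_; _∉_; _⊆_; _⊂_; _∪_; _∩_; ⁅_⁆; ∣_∣)
  renaming (⊥ to ∅; ⊤ to Full)
open import Data.Fin.Subset.Properties
open import Relation.Binary.PropositionalEquality
open ≡-Reasoning
open import Relation.Nullary using (Dec; yes; no; ¬_; does)
open import Relation.Nullary.Decidable.Core using (T?; ¬?; _×-dec_)

Σlist : {A : Set} → (A → ℤ) → List A → ℤ
Σlist f xs = sumℤ (map f xs)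

Σlist-cong : {A : Set} {f g : A → ℤ} (xs : List A) → (∀ x → f x ≡ g x) → Σlist f xs ≡ Σlist g xs
Σlist-cong [] e = refl
Σlist-cong (x ∷ xs) e = cong₂ _+_ (e x) (Σlist-cong xs e)

Σlist-+ : {A : Set} (f g : A → ℤ) (xs : List A) → Σlist (λ x → f x + g x) xs ≡ Σlist f xs + Σlist g xs
Σlist-+ f g [] = refl
Σlist-+ f g (x ∷ xs) rewrite Σlist-+ f g xs = lem (f x) (g x) (Σlist f xs) (Σlist g xs)
  where
  lem : ∀ a b c d → a + b + (c + d) ≡ a + c + (b + d)
  lem = solve-∀

Σlist-* : {A : Set} (a : ℤ) (f : A → ℤ) (xs : List A) → Σlist (λ x → a * f x) xs ≡ a * Σlist f xs
Σlist-* a f [] = sym (ℤP.*-zeroʳ a)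
Σlist-* a f (x ∷ xs) rewrite Σlist-* a f xs = sym (ℤP.*-distribˡ-+ a (f x) (Σlist f xs))

Σlist-0 : {A : Set} (xs : List A) → Σlist (λ _ → 0ℤ) xs ≡ 0ℤ
Σlist-0 [] = refl
Σlist-0 (x ∷ xs) rewrite Σlist-0 xs = refl

Σlist-neg : {A : Set} (f : A → ℤ) (xs : List A) → Σlist (λ x → - f x) xs ≡ - Σlist f xs
Σlist-neg f [] = refl
Σlist-neg f (x ∷ xs) rewrite Σlist-neg f xs = sym (ℤP.neg-distrib-+ (f x) (Σlist f xs))

Σlist-- : {A : Set} (f g : A → ℤ) (xs : List A) → Σlist (λ x → f x - g x) xs ≡ Σlist f xs - Σlist g xs
Σlist-- f g xs = trans (Σlist-+ f (λ x → - g x) xs) (cong (Σlist f xs +_) (Σlist-neg g xs))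

Σlist-++ : {A : Set} (f : A → ℤ) (xs ys : List A) → Σlist f (xs ++ ys) ≡ Σlist f xs + Σlist f ys
Σlist-++ f [] ys = sym (ℤP.+-identityˡ _)
Σlist-++ f (x ∷ xs) ys rewrite Σlist-++ f xs ys = sym (ℤP.+-assoc (f x) (Σlist f xs) (Σlist f ys))

Σlist-map : {A B : Set} (f : B → ℤ) (h : A → B) (xs : List A) → Σlist f (map h xs) ≡ Σlist (λ x → f (h x)) xs
Σlist-map f h [] = refl
Σlist-map f h (x ∷ xs) = cong (f (h x) +_) (Σlist-map f h xs)

Σlist-swap : {A B : Set} (g : A → B → ℤ) (xs : List A) (ys : List B) →
  Σlist (λ a → Σlist (g a) ys) xs ≡ Σlist (λ b → Σlist (λ a → g a b) xs) ys
Σlist-swap g [] ys = sym (Σlist-0 ys)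
Σlist-swap g (x ∷ xs) ys rewrite Σlist-swap g xs ys = sym (Σlist-+ (g x) (λ b → Σlist (λ a → g a b) xs) ys)

ΣSub-suc : (m : ℕ) (f : Subset (suc m) → ℤ) →
  ΣSub (suc m) f ≡ ΣSub m (λ S → f (outside ∷ S)) + ΣSub m (λ S → f (inside ∷ S))
ΣSub-suc m f = trans (Σlist-++ f (map (outside ∷_) (allSubsets m)) (map (inside ∷_) (allSubsets m)))
  (cong₂ _+_ (Σlist-map f (outside ∷_) (allSubsets m)) (Σlist-map f (inside ∷_) (allSubsets m)))

ΣSub-cong : (m : ℕ) {f g : Subset m → ℤ} → (∀ S → f S ≡ g S) → ΣSub m f ≡ ΣSub m g
ΣSub-cong m e = Σlist-cong (allSubsets m) e

ΣSub-0 : (m : ℕ) {f : Subset m → ℤ} → (∀ S → f S ≡ 0ℤ) → ΣSub m f ≡ 0ℤ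
ΣSub-0 m e = trans (ΣSub-cong m e) (Σlist-0 (allSubsets m))

ΣSub-single : (m : ℕ) (f : Subset m → ℤ) (S0 : Subset m) →
  (∀ S → ¬ (S ≡ S0) → f S ≡ 0ℤ) → ΣSub m f ≡ f S0
ΣSub-single zero f [] h = ℤP.+-identityʳ (f [])
ΣSub-single (suc m) f (outside ∷ S0) h = begin
    ΣSub (suc m) f
  ≡⟨ ΣSub-suc m f ⟩
    ΣSub m (λ S → f (outside ∷ S)) + ΣSub m (λ S → f (inside ∷ S))
  ≡⟨ cong₂ _+_ (ΣSub-single m (λ S → f (outside ∷ S)) S0 (λ S ne → h _ (λ e → ne (VecP.∷-injectiveʳ e))))
               (ΣSub-0 m (λ S → h _ (λ ()))) ⟩
    f (outside ∷ S0) + 0ℤ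
  ≡⟨ ℤP.+-identityʳ _ ⟩
    f (outside ∷ S0) ∎
ΣSub-single (suc m) f (inside ∷ S0) h = begin
    ΣSub (suc m) f
  ≡⟨ ΣSub-suc m f ⟩
    ΣSub m (λ S → f (outside ∷ S)) + ΣSub m (λ S → f (inside ∷ S))
  ≡⟨ cong₂ _+_ (ΣSub-0 m (λ S → h _ (λ ())))
               (ΣSub-single m (λ S → f (inside ∷ S)) S0 (λ S ne → h _ (λ e → ne (VecP.∷-injectiveʳ e)))) ⟩
    0ℤ + f (inside ∷ S0)
  ≡⟨ ℤP.+-identityˡ _ ⟩
    f (inside ∷ S0) ∎

ΣSub-+ : (m : ℕ) (f g : Subset m → ℤ) → ΣSub m (λ S → f S + g S) ≡ ΣSub m f + ΣSub m g
ΣSub-+ m f g = Σlist-+ f g (allSubsets m)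

ΣSub-- : (m : ℕ) (f g : Subset m → ℤ) → ΣSub m (λ S → f S - g S) ≡ ΣSub m f - ΣSub m g
ΣSub-- m f g = Σlist-- f g (allSubsets m)

ΣSub-* : (m : ℕ) (a : ℤ) (f : Subset m → ℤ) → ΣSub m (λ S → a * f S) ≡ a * ΣSub m f
ΣSub-* m a f = Σlist-* a f (allSubsets m)

ΣSub-*ʳ : ∀ m (f : Subset m → ℤ) (x : ℤ) → ΣSub m (λ F → f F * x) ≡ ΣSub m f * x
ΣSub-*ʳ m f x = trans (ΣSub-cong m (λ F → ℤP.*-comm (f F) x)) (trans (ΣSub-* m x f) (ℤP.*-comm x (ΣSub m f)))

ΣSub-swap : (m : ℕ) (g : Subset m → Subset m → ℤ) →
  ΣSub m (λ S → ΣSub m (λ T → g S T)) ≡ ΣSub m (λ T → ΣSub m (λ S → g S T))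
ΣSub-swap m g = Σlist-swap g (allSubsets m) (allSubsets m)

ΣFin-suc : ∀ n (f : Fin (suc n) → ℤ) → ΣFin (suc n) f ≡ f zero + ΣFin n (λ i → f (suc i))
ΣFin-suc n f = cong (f zero +_) (cong sumℤ (trans (ListP.map-tabulate suc f) (sym (ListP.map-tabulate (λ i → i) (λ i → f (suc i))))))

ΣFin-* : ∀ n (a : ℤ) (f : Fin n → ℤ) → ΣFin n (λ i → a * f i) ≡ a * ΣFin n f
ΣFin-* n a f = Σlist-* a f (allFin n)

ΣFin-0 : ∀ n (f : Fin n → ℤ) → (∀ i → f i ≡ 0ℤ) → ΣFin n f ≡ 0ℤ
ΣFin-0 n f h = trans (Σlist-cong (allFin n) h) (Σlist-0 (allFin n))

Σupto-cong : ∀ N (f g : ℕ → ℤ) → (∀ d → d ≤ N → f d ≡ g d) → Σupto N f ≡ Σupto N g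
Σupto-cong zero f g h = h 0 z≤n
Σupto-cong (suc N) f g h = cong₂ _+_ (Σupto-cong N f g (λ d d≤ → h d (ℕP.m≤n⇒m≤1+n d≤))) (h (suc N) ℕP.≤-refl)

Σupto-- : ∀ N (f g : ℕ → ℤ) → Σupto N (λ d → f d - g d) ≡ Σupto N f - Σupto N g
Σupto-- zero f g = refl
Σupto-- (suc N) f g rewrite Σupto-- N f g = lem (Σupto N f) (Σupto N g) (f (suc N)) (g (suc N))
  where lem : ∀ a b c d → a - b + (c - d) ≡ a + c - (b + d)
        lem = solve-∀

Σupto-* : ∀ N (c : ℤ) (f : ℕ → ℤ) → Σupto N (λ d → c * f d) ≡ c * Σupto N f
Σupto-* zero c f = refl
Σupto-* (suc N) c f rewrite Σupto-* N c f = sym (ℤP.*-distribˡ-+ c (Σupto N f) (f (suc N)))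

Σupto-0 : ∀ N (f : ℕ → ℤ) → (∀ d → d ≤ N → f d ≡ 0ℤ) → Σupto N f ≡ 0ℤ
Σupto-0 zero f h = h 0 z≤n
Σupto-0 (suc N) f h rewrite Σupto-0 N f (λ d d≤ → h d (ℕP.m≤n⇒m≤1+n d≤)) | h (suc N) ℕP.≤-refl = refl

Σupto-single : ∀ N k (g : ℕ → ℤ) → k ≤ N → (∀ d → d ≤ N → ¬ (d ≡ k) → g d ≡ 0ℤ) → Σupto N g ≡ g k
Σupto-single zero zero g k≤ h = refl
Σupto-single (suc N) k g k≤ h with k ℕP.≤? N
... | yes k≤N = trans (cong₂ _+_ (Σupto-single N k g k≤N (λ d d≤ ne → h d (ℕP.m≤n⇒m≤1+n d≤) ne))
                                  (h (suc N) ℕP.≤-refl (λ e → ℕP.<-irrefl (sym e) (s≤s k≤N))))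
                      (ℤP.+-identityʳ (g k))
... | no k≰N with ℕP.≤-antisym k≤ (ℕP.≰⇒> k≰N)
...   | refl = trans (cong (_+ g (suc N)) (Σupto-0 N g (λ d d≤ → h d (ℕP.m≤n⇒m≤1+n d≤) (λ e → ℕP.<-irrefl e (s≤s d≤)))))
                     (ℤP.+-identityˡ (g (suc N)))

ΣSub-Σupto : ∀ m N (g : Subset m → ℕ → ℤ) → ΣSub m (λ F → Σupto N (g F)) ≡ Σupto N (λ d → ΣSub m (λ F → g F d))
ΣSub-Σupto m zero g = refl
ΣSub-Σupto m (suc N) g = trans (ΣSub-+ m (λ F → Σupto N (g F)) (λ F → g F (suc N))) (cong (_+ ΣSub m (λ F → g F (suc N))) (ΣSub-Σupto m N g))

x*yz≡y*xz : ∀ a b c → a * (b * c) ≡ b * (a * c)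
x*yz≡y*xz = solve-∀

+≡0⇒b≡-a : ∀ a b → a + b ≡ 0ℤ → b ≡ - a
+≡0⇒b≡-a a b e = trans (sym (lem a b)) (trans (cong (λ z → z - a) e) (ℤP.+-identityˡ (- a)))
  where lem : ∀ a b → a + b - a ≡ b
        lem = solve-∀

+≡0⇒a≡-b : ∀ a b → a + b ≡ 0ℤ → a ≡ - b
+≡0⇒a≡-b a b e = +≡0⇒b≡-a b a (trans (ℤP.+-comm b a) e)

-1^k*-1^k : ∀ k → (-1ℤ ^ k) * (-1ℤ ^ k) ≡ 1ℤ
-1^k*-1^k zero = refl
-1^k*-1^k (suc k) = trans (lem (-1ℤ ^ k)) (-1^k*-1^k k)
  where lem : ∀ p → (-1ℤ * p) * (-1ℤ * p) ≡ p * p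
        lem = solve-∀

⟦_⟧ : {P : Set} → Dec P → ℤ

⟦ yes _ ⟧ = 1ℤ
⟦ no _ ⟧ = 0ℤ

⟦⟧-yes : {P : Set} (d : Dec P) → P → ⟦ d ⟧ ≡ 1ℤ
⟦⟧-yes (yes _) p = refl
⟦⟧-yes (no ¬p) p = ⊥-elim (¬p p)

⟦⟧-no : {P : Set} (d : Dec P) → ¬ P → ⟦ d ⟧ ≡ 0ℤ
⟦⟧-no (yes p) ¬p = ⊥-elim (¬p p)
⟦⟧-no (no _) ¬p = refl

⟦⟧-iff : {P Q : Set} (d : Dec P) (e : Dec Q) → (P → Q) → (Q → P) → ⟦ d ⟧ ≡ ⟦ e ⟧
⟦⟧-iff (yes p) e pq qp = sym (⟦⟧-yes e (pq p))
⟦⟧-iff (no ¬p) e pq qp = sym (⟦⟧-no e (λ q → ¬p (qp q)))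

⟦⟧-× : {P Q : Set} (d : Dec P) (e : Dec Q) → ⟦ d ×-dec e ⟧ ≡ ⟦ d ⟧ * ⟦ e ⟧
⟦⟧-× (yes p) (yes q) = refl
⟦⟧-× (yes p) (no _) = refl
⟦⟧-× (no _) (yes _) = refl
⟦⟧-× (no _) (no _) = refl

ind-mul-yes : {P : Set} (d : Dec P) (a : ℤ) → P → ⟦ d ⟧ * a ≡ a
ind-mul-yes d a p rewrite ⟦⟧-yes d p = ℤP.*-identityˡ a

ind-mul-no : {P : Set} (d : Dec P) (a : ℤ) → ¬ P → ⟦ d ⟧ * a ≡ 0ℤ
ind-mul-no d a ¬p rewrite ⟦⟧-no d ¬p = ℤP.*-zeroˡ a

if-cases : ∀ (b : Bool) (a : ℤ) → (T b × (if b then a else 0ℤ) ≡ a) ⊎ (¬ T b × (if b then a else 0ℤ) ≡ 0ℤ)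
if-cases true a = inj₁ (tt , refl)
if-cases false a = inj₂ ((λ ()) , refl)

if-∧-does : {P : Set} (b : Bool) (d : Dec P) (a : ℤ) → (if b ∧ does d then a else 0ℤ) ≡ ⟦ T? b ×-dec d ⟧ * a
if-∧-does true (yes p) a = sym (ℤP.*-identityˡ a)
if-∧-does true (no p) a = sym (ℤP.*-zeroˡ a)
if-∧-does false (yes p) a = sym (ℤP.*-zeroˡ a)
if-∧-does false (no p) a = sym (ℤP.*-zeroˡ a)

∧-intro : ∀ {a b} → T a → T b → T (a ∧ b)
∧-intro {true} {true} _ _ = tt

∧-fst : ∀ {a b} → T (a ∧ b) → T a
∧-fst {true} _ = tt

∧-snd : ∀ {a b} → T (a ∧ b) → T b
∧-snd {true} {true} _ = tt

T-not-does : {P : Set} (d : Dec P) → ¬ P → T (not (does d))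
T-not-does (yes p) ¬p = ¬p p
T-not-does (no _) _ = tt

T-does : {P : Set} (d : Dec P) → P → T (does d)
T-does (yes _) _ = tt
T-does (no ¬p) p = ¬p p

does-T : {P : Set} (d : Dec P) → T (does d) → P
does-T (yes p) _ = p

not-does-T : {P : Set} (d : Dec P) → T (not (does d)) → ¬ P
not-does-T (no ¬p) _ = ¬p

allB-sound : {A : Set} (p : A → Bool) (xs : List A) → T (allB p xs) → ∀ {x} → x LM.∈ xs → T (p x)
allB-sound p (a ∷ xs) h (here refl) with p a
... | true = tt
allB-sound p (a ∷ xs) h (there i) with p a
... | true = allB-sound p xs h i

allB-complete : {A : Set} (p : A → Bool) (xs : List A) → (∀ x → T (p x)) → T (allB p xs)
allB-complete p [] h = tt
allB-complete p (a ∷ xs) h with p a | h a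
... | true | _ = allB-complete p xs h

allB-mem : {A : Set} (p : A → Bool) (xs : List A) → (∀ {x} → x LM.∈ xs → T (p x)) → T (allB p xs)
allB-mem p [] h = tt
allB-mem p (a ∷ xs) h = ∧-intro (h (here refl)) (allB-mem p xs (λ i → h (there i)))

∈⇒lookup : ∀ {m} {x : Fin m} {S : Subset m} → x ∈ S → lookup S x ≡ true
∈⇒lookup = []=⇒lookup

lookup⇒∈ : ∀ {m} {x : Fin m} {S : Subset m} → lookup S x ≡ true → x ∈ S
lookup⇒∈ {x = x} {S} = lookup⇒[]= x S

∉⇒lookup : ∀ {m} {x : Fin m} {S : Subset m} → x ∉ S → lookup S x ≡ false
∉⇒lookup {x = x} {S} h with lookup S x in eq
... | true = ⊥-elim (h (lookup⇒∈ eq))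
... | false = refl

⊈-witness : ∀ {m} (P Q : Subset m) → ¬ (P ⊆ Q) → ∃ λ y → y ∈ P × y ∉ Q
⊈-witness {m} P Q h with FinP.any? (λ y → (y ∈? P) ×-dec ¬? (y ∈? Q))
... | yes (y , a , b) = y , a , b
... | no nn = ⊥-elim (h λ {y} y∈P → case (y ∈? Q) y∈P nn)
  where case : ∀ {y} → Dec (y ∈ Q) → y ∈ P → ¬ (∃ λ z → z ∈ P × z ∉ Q) → y ∈ Q
        case (yes q) _ _ = q
        case {y} (no q) p nn = ⊥-elim (nn (y , p , q))

⊆∧⊉⇒⊂ : ∀ {m} {P Q : Subset m} → P ⊆ Q → ¬ (Q ⊆ P) → P ⊂ Q
⊆∧⊉⇒⊂ {P = P} {Q} pq nqp with ⊈-witness Q P nqp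
... | y , a , b = pq , y , a , b

⊈∅-witness : ∀ {m} (S : Subset m) → ¬ (S ⊆ ∅) → ∃ λ y → y ∈ S
⊈∅-witness S h with ⊈-witness S ∅ h
... | y , a , _ = y , a

_≟S_ : ∀ {m} → (A B : Subset m) → Dec (A ≡ B)
_≟S_ = VecP.≡-dec BoolP._≟_

eS-in : ∀ {m} {S : Subset m} {x} → x ∈ S → eS S x ≡ 1ℤ
eS-in {S = S} {x} x∈ rewrite ∈⇒lookup x∈ = refl

eS-out : ∀ {m} {S : Subset m} {x} → x ∉ S → eS S x ≡ 0ℤ
eS-out {S = S} {x} x∉ rewrite ∉⇒lookup x∉ = refl

eS-≥0 : ∀ {m} (S : Subset m) x → 0ℤ ℤ.≤ eS S x
eS-≥0 S x with lookup S x
... | true = ℤ.+≤+ z≤n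
... | false = ℤ.+≤+ z≤n

-eS-≥-1 : ∀ {m} (S : Subset m) x → -1ℤ ℤ.≤ - eS S x
-eS-≥-1 S x with lookup S x
... | true = ℤP.≤-refl
... | false = ℤ.-≤+

nonemptyProper-witnesses : ∀ {m} (S : Subset m) → T (nonemptyProper S) → (∃ λ y → y ∈ S) × (∃ λ y → y ∉ S)
nonemptyProper-witnesses S h = ⊈∅-witness S (not-does-T (S ⊆? ∅) (∧-fst h)) ,
  (let (y , _ , y∉) = ⊈-witness Full S (not-does-T (Full ⊆? S) (∧-snd {not (does (S ⊆? ∅))} h)) in y , y∉)

ins-mem : ∀ {m} (S : Subset m) τ → S LM.∈ insertS S τ
ins-mem S [] = here refl
ins-mem S (T ∷ τ) with S ⊆? T
... | yes _ = here refl
... | no _ = there (ins-mem S τ)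

chain-np : ∀ {m} (σ : List (Subset m)) → T (isChain σ) → ∀ {S} → S LM.∈ σ → T (nonemptyProper S)
chain-np (G ∷ []) h (here refl) = h
chain-np (G ∷ H ∷ σ) h (here refl) = ∧-fst h
chain-np (G ∷ H ∷ σ) h (there i) = chain-np (H ∷ σ) (∧-snd (∧-snd {does (G ⊂? H)} (∧-snd {nonemptyProper G} h))) i

chain-tail : ∀ {m} (G H : Subset m) σ → T (isChain (G ∷ H ∷ σ)) → T (isChain (H ∷ σ))
chain-tail G H σ h = ∧-snd {does (G ⊂? H)} (∧-snd {nonemptyProper G} h)

chain-⊂ : ∀ {m} (G H : Subset m) σ → T (isChain (G ∷ H ∷ σ)) → G ⊂ H
chain-⊂ G H σ h = does-T (G ⊂? H) (∧-fst (∧-snd {nonemptyProper G} h))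

chain-head : ∀ {m} (G : Subset m) σ → T (isChain (G ∷ σ)) → ∀ {S} → S LM.∈ (G ∷ σ) → G ⊆ S
chain-head G σ h (here refl) = λ z → z
chain-head G (H ∷ σ) h (there i) = ⊆-trans (proj₁ (chain-⊂ G H σ h)) (chain-head H σ (chain-tail G H σ h) i)

lastOf : ∀ {m} → Subset m → List (Subset m) → Subset m
lastOf G [] = G
lastOf G (H ∷ σ) = lastOf H σ

lastOf-mem : ∀ {m} (G : Subset m) σ → lastOf G σ LM.∈ (G ∷ σ)
lastOf-mem G [] = here refl
lastOf-mem G (H ∷ σ) = there (lastOf-mem H σ)

chain-last : ∀ {m} (G : Subset m) σ → T (isChain (G ∷ σ)) → ∀ {S} → S LM.∈ (G ∷ σ) → S ⊆ lastOf G σ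
chain-last G [] h (here refl) = λ z → z
chain-last G (H ∷ σ) h (here refl) = ⊆-trans (proj₁ (chain-⊂ G H σ h)) (chain-last H σ (chain-tail G H σ h) (here refl))
chain-last G (H ∷ σ) h (there i) = chain-last H σ (chain-tail G H σ h) i

poly : (ℕ → ℤ) → ℕ → ℤ → ℤ
poly f N q = Σupto N (λ d → f d * q ^ (N ∸ d))

poly-suc : ∀ f N q → poly f (suc N) q ≡ q * poly f N q + f (suc N)
poly-suc f N q = cong₂ _+_ part (trans (cong (f (suc N) *_) (cong (q ^_) (ℕP.n∸n≡0 N))) (ℤP.*-identityʳ (f (suc N))))
  where
  lem : ∀ a q e → a * (q * e) ≡ q * (a * e)
  lem = solve-∀
  part : Σupto N (λ d → f d * q ^ (suc N ∸ d)) ≡ q * poly f N q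
  part = trans (Σupto-cong N _ _ (λ d d≤ → trans (cong (λ z → f d * q ^ z) (ℕP.+-∸-assoc 1 d≤)) (lem (f d) q (q ^ (N ∸ d)))))
               (Σupto-* N q (λ d → f d * q ^ (N ∸ d)))

poly-- : ∀ f g N q → poly (λ d → f d - g d) N q ≡ poly f N q - poly g N q
poly-- f g N q = trans (Σupto-cong N _ _ (λ d _ → lem (f d) (g d) (q ^ (N ∸ d)))) (Σupto-- N _ _)
  where
  lem : ∀ a b x → (a - b) * x ≡ a * x - b * x
  lem = solve-∀

Σℕupto : ℕ → (ℕ → ℕ) → ℕ
Σℕupto zero f = f 0
Σℕupto (suc N) f = Σℕupto N f ℕ.+ f (suc N)

Σℕupto-≥ : ∀ N f d → d ≤ N → f d ≤ Σℕupto N f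
Σℕupto-≥ zero f zero _ = ℕP.≤-refl
Σℕupto-≥ (suc N) f d d≤ with d ℕP.≟ suc N
... | yes refl = ℕP.m≤n+m (f (suc N)) (Σℕupto N f)
... | no ne = ℕP.≤-trans (Σℕupto-≥ N f d (ℕP.≤-pred (ℕP.≤∧≢⇒< d≤ ne))) (ℕP.m≤m+n (Σℕupto N f) (f (suc N)))

-- By Horner's scheme at q = B the constant coefficient is B times an integer, yet smaller than
-- B in absolute value; so it vanishes, and so does the value of the truncated polynomial.
poly≡0⇒coeffs≡0 : ∀ N (B : ℕ) (p : ℕ → ℤ) → (∀ d → d ≤ N → ℤ.∣ p d ∣ < B) → poly p N (ℤ.+ B) ≡ 0ℤ → ∀ d → d ≤ N → p d ≡ 0ℤ
poly≡0⇒coeffs≡0 zero B p bd e zero _ = trans (sym (ℤP.*-identityʳ (p 0))) e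
poly≡0⇒coeffs≡0 (suc N) B p bd e d d≤ = go (ℤ.∣ h ∣) refl
  where
  h = poly p N (ℤ.+ B)
  e1 : ℤ.+ B * h + p (suc N) ≡ 0ℤ
  e1 = trans (sym (poly-suc p N (ℤ.+ B))) e
  pN : p (suc N) ≡ - (ℤ.+ B * h)
  pN = +≡0⇒b≡-a (ℤ.+ B * h) (p (suc N)) e1
  absp : ℤ.∣ p (suc N) ∣ ≡ B ℕ.* ℤ.∣ h ∣
  absp = trans (cong ℤ.∣_∣ pN) (trans (ℤP.∣-i∣≡∣i∣ (ℤ.+ B * h)) (ℤP.abs-* (ℤ.+ B) h))
  go : ∀ k → ℤ.∣ h ∣ ≡ k → p d ≡ 0ℤ
  go (suc k) ek = ⊥-elim (ℕP.<-irrefl refl (ℕP.<-≤-trans (bd (suc N) ℕP.≤-refl)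
                    (ℕP.≤-trans (ℕP.≤-trans (ℕP.m≤m*n B (suc k)) (ℕP.≤-reflexive (cong (B ℕ.*_) (sym ek)))) (ℕP.≤-reflexive (sym absp)))))
  go zero ek with d ℕP.≟ suc N
  ... | yes refl = trans pN (trans (cong (λ z → - (ℤ.+ B * z)) (ℤP.∣i∣≡0⇒i≡0 ek)) (cong -_ (ℤP.*-zeroʳ (ℤ.+ B))))
  ... | no ne = poly≡0⇒coeffs≡0 N B p (λ d' d'≤ → bd d' (ℕP.m≤n⇒m≤1+n d'≤)) (ℤP.∣i∣≡0⇒i≡0 ek) d (ℕP.≤-pred (ℕP.≤∧≢⇒< d≤ ne))

-- The coefficients of (q - 1) * poly a r q are the differences of consecutive a's,
-- so comparing coefficients at one large value of q recovers a as partial sums of C.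
module CoeffExtraction (r : ℕ) (C a : ℕ → ℤ) (hyp : ∀ q → poly C (suc r) q ≡ (q - 1ℤ) * poly a r q) where

  shifted : ℕ → ℤ
  shifted zero = 0ℤ
  shifted (suc d) = a d

  truncated : ℕ → ℤ
  truncated d = if d ≤ᵇ r then a d else 0ℤ

  difference : ℕ → ℤ
  difference d = truncated d - shifted d

  truncated-≤ : ∀ d → d ≤ r → truncated d ≡ a d
  truncated-≤ d d≤ with d ≤ᵇ r | ℕP.≤⇒≤ᵇ d≤
  ... | true | _ = refl

  truncated-1+r : truncated (suc r) ≡ 0ℤ
  truncated-1+r with suc r ≤ᵇ r in eq
  ... | false = refl
  ... | true = ⊥-elim (ℕP.<-irrefl refl (ℕP.≤ᵇ⇒≤ (suc r) r (subst T (sym eq) _)))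

  poly-shift : ∀ N q → poly shifted (suc N) q ≡ poly a N q
  poly-shift zero q = trans (poly-suc shifted 0 q) (lem q (a 0))
    where lem : ∀ q a → q * (0ℤ * 1ℤ) + a ≡ a * 1ℤ
          lem = solve-∀
  poly-shift (suc N) q = trans (poly-suc shifted (suc N) q) (trans (cong (λ z → q * z + a (suc N)) (poly-shift N q)) (sym (poly-suc a N q)))

  poly-difference : ∀ q → poly difference (suc r) q ≡ (q - 1ℤ) * poly a r q
  poly-difference q = trans (poly-- truncated shifted (suc r) q)
         (trans (cong₂ _-_ (trans (poly-suc truncated r q) (cong₂ (λ u v → q * u + v) (Σupto-cong r _ _ (λ d d≤ → cong (_* q ^ (r ∸ d)) (truncated-≤ d d≤))) truncated-1+r))
                           (poly-shift r q))
           (lem q (poly a r q)))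
    where lem : ∀ q h → q * h + 0ℤ - h ≡ (q - 1ℤ) * h
          lem = solve-∀

  residual : ℕ → ℤ
  residual d = C d - difference d

  poly-residual : ∀ q → poly residual (suc r) q ≡ 0ℤ
  poly-residual q = trans (poly-- C difference (suc r) q) (trans (cong₂ _-_ (hyp q) (poly-difference q)) (ℤP.+-inverseʳ ((q - 1ℤ) * poly a r q)))

  bound : ℕ
  bound = suc (Σℕupto (suc r) (λ d → ℤ.∣ residual d ∣))

  residual≡0 : ∀ d → d ≤ suc r → residual d ≡ 0ℤ
  residual≡0 = poly≡0⇒coeffs≡0 (suc r) bound residual (λ d d≤ → s≤s (Σℕupto-≥ (suc r) (λ d → ℤ.∣ residual d ∣) d d≤)) (poly-residual (ℤ.+ bound))

  C≡difference : ∀ d → d ≤ suc r → C d ≡ difference d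
  C≡difference d d≤ = trans (sym (lem (C d) (difference d))) (trans (cong (_+ difference d) (residual≡0 d d≤)) (ℤP.+-identityˡ (difference d)))
    where lem : ∀ c b → c - b + b ≡ c
          lem = solve-∀

  telescope : ∀ k → Σupto k (λ d → a d - shifted d) ≡ a k
  telescope zero = ℤP.+-identityʳ (a 0)
  telescope (suc k) rewrite telescope k = lem (a k) (a (suc k))
    where lem : ∀ x y → x + (y - x) ≡ y
          lem = solve-∀

  coeff≡partialSum : ∀ k → k ≤ r → a k ≡ Σupto k C
  coeff≡partialSum k k≤ = sym (trans (Σupto-cong k C (λ d → a d - shifted d)
                   (λ d d≤ → trans (C≡difference d (ℕP.≤-trans d≤ (ℕP.m≤n⇒m≤1+n k≤))) (cong (_- shifted d) (truncated-≤ d (ℕP.≤-trans d≤ k≤)))))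
                 (telescope k))

foldr⊓-≥ : ∀ {k} (a : ℤ) (y : Fin k → ℤ) (z : ℤ) (xs : List (Fin k)) → a ℤ.≤ z → (∀ i → a ℤ.≤ y i) →
  a ℤ.≤ L.foldr (λ i acc → y i ⊓ acc) z xs
foldr⊓-≥ a y z [] az ay = az
foldr⊓-≥ a y z (i ∷ xs) az ay with ℤP.⊓-sel (y i) (L.foldr (λ i acc → y i ⊓ acc) z xs)
... | inj₁ e = subst (a ℤ.≤_) (sym e) (ay i)
... | inj₂ e = subst (a ℤ.≤_) (sym e) (foldr⊓-≥ a y z xs az ay)

foldr⊓-≡ : ∀ {k} (a : ℤ) (y : Fin k → ℤ) (z : ℤ) (xs : List (Fin k)) → a ℤ.≤ z → (∀ i → a ℤ.≤ y i) →
  ∀ {j} → j LM.∈ xs → y j ≡ a → L.foldr (λ i acc → y i ⊓ acc) z xs ≡ a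
foldr⊓-≡ a y z (i ∷ xs) az ay (here refl) e rewrite e = ℤP.i≤j⇒i⊓j≡i (foldr⊓-≥ a y z xs az ay)
foldr⊓-≡ a y z (i ∷ xs) az ay (there j∈) e rewrite foldr⊓-≡ a y z xs az ay j∈ e = ℤP.i≥j⇒i⊓j≡j (ay i)

α-eS : ∀ {n} (S : Subset (suc n)) → T (nonemptyProper S) → α (eS S) ≡ - eS S zero
α-eS {n} S h with nonemptyProper-witnesses S h
... | _ , (y , y∉) = trans (cong (_- eS S zero) (foldr⊓-≡ 0ℤ (eS S) (eS S zero) (allFin (suc n)) (eS-≥0 S zero) (eS-≥0 S) (∈-allFin y) (eS-out y∉)))
                      (ℤP.+-identityˡ (- eS S zero))

crem-eS : ∀ {n} (S : Subset (suc n)) → T (nonemptyProper S) → cremα (eS S) ≡ eS S zero - 1ℤ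
crem-eS {n} S h with nonemptyProper-witnesses S h
... | (y , y∈) , _ = trans (cong (_- (- eS S zero)) (foldr⊓-≡ -1ℤ (λ i → - eS S i) (- eS S zero) (allFin (suc n)) (-eS-≥-1 S zero) (-eS-≥-1 S) (∈-allFin y) (cong -_ (eS-in y∈))))
  (lem (eS S zero))
  where lem : ∀ e → -1ℤ - (- e) ≡ e - 1ℤ
        lem = solve-∀

wExt-α : ∀ {n} (w : Weight (suc n)) τ S → wExt w τ S * α (eS S) ≡ - (wExt w τ S * eS S zero)
wExt-α w τ S with if-cases (isChain (insertS S τ)) (w (insertS S τ))
... | inj₁ (ch , e) rewrite α-eS S (chain-np (insertS S τ) ch (ins-mem S τ)) = sym (ℤP.neg-distribʳ-* (wExt w τ S) (eS S zero))
... | inj₂ (_ , e) rewrite e = refl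

wExt-crem : ∀ {n} (w : Weight (suc n)) τ S → wExt w τ S * cremα (eS S) ≡ wExt w τ S * eS S zero - wExt w τ S
wExt-crem w τ S with if-cases (isChain (insertS S τ)) (w (insertS S τ))
... | inj₁ (ch , e) rewrite crem-eS S (chain-np (insertS S τ) ch (ins-mem S τ)) = lem (wExt w τ S) (eS S zero)
  where lem : ∀ a e → a * (e - 1ℤ) ≡ a * e - a
        lem = solve-∀
... | inj₂ (_ , e) rewrite e = refl

-- Since α(e_S) = - e_S(0) on proper subsets, the cap product is the constant term t of the
-- balancing sum in the basis e_{τᵢ}, which is its value at any coordinate outside every τᵢ.
product-α : ∀ {n} (w w' : Weight (suc n)) → IsProduct α w w' → ∀ τ → T (isChain τ) →
  (c : Fin (length τ) → ℤ) (t : ℤ) → (∀ x → balSum w τ x ≡ ΣFin (length τ) (λ i → c i * eS (L.lookup τ i) x) + t) →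
  ∀ x1 → (∀ {G} → G LM.∈ τ → x1 ∉ G) → w' τ ≡ balSum w τ x1
product-α {n} w w' prod τ ch c t dec x1 out = begin
    w' τ
  ≡⟨ prod τ ch c t dec ⟩
    ΣFin (length τ) (λ i → c i * α (eS (L.lookup τ i))) - ΣSub (suc n) (λ S → wExt w τ S * α (eS S))
  ≡⟨ cong₂ _-_ E1 E2 ⟩
    - ΣFin (length τ) (λ i → c i * eS (L.lookup τ i) zero) - (- balSum w τ zero)
  ≡⟨ cong (λ z → - ΣFin (length τ) (λ i → c i * eS (L.lookup τ i) zero) - (- z)) (dec zero) ⟩
    - ΣFin (length τ) (λ i → c i * eS (L.lookup τ i) zero) - (- (ΣFin (length τ) (λ i → c i * eS (L.lookup τ i) zero) + t))
  ≡⟨ lem (ΣFin (length τ) (λ i → c i * eS (L.lookup τ i) zero)) t ⟩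
    0ℤ + t
  ≡⟨ cong (_+ t) (sym (ΣFin-0 (length τ) _ (λ i → trans (cong (c i *_) (eS-out (out (∈-lookup i)))) (ℤP.*-zeroʳ (c i))))) ⟩
    ΣFin (length τ) (λ i → c i * eS (L.lookup τ i) x1) + t
  ≡⟨ sym (dec x1) ⟩
    balSum w τ x1 ∎
  where
  lem : ∀ a t → - a - (- (a + t)) ≡ 0ℤ + t
  lem = solve-∀
  E1 : ΣFin (length τ) (λ i → c i * α (eS (L.lookup τ i))) ≡ - ΣFin (length τ) (λ i → c i * eS (L.lookup τ i) zero)
  E1 = trans (Σlist-cong (allFin (length τ)) (λ i → trans (cong (c i *_) (α-eS (L.lookup τ i) (chain-np τ ch (∈-lookup i))))
                                                       (sym (ℤP.neg-distribʳ-* (c i) _))))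
             (Σlist-neg (λ i → c i * eS (L.lookup τ i) zero) (allFin (length τ)))
  E2 : ΣSub (suc n) (λ S → wExt w τ S * α (eS S)) ≡ - balSum w τ zero
  E2 = trans (ΣSub-cong (suc n) (wExt-α w τ)) (Σlist-neg (λ S → wExt w τ S * eS S zero) (allSubsets (suc n)))

-- Dually, Crem*α(e_S) = e_S(0) - 1 makes the cap product Σ w(σ) minus the balancing sum at
-- any coordinate inside every τᵢ.
product-cremα : ∀ {n} (w w' : Weight (suc n)) → IsProduct cremα w w' → ∀ τ → T (isChain τ) →
  (c : Fin (length τ) → ℤ) (t : ℤ) → (∀ x → balSum w τ x ≡ ΣFin (length τ) (λ i → c i * eS (L.lookup τ i) x) + t) →
  ∀ x0 → (∀ {G} → G LM.∈ τ → x0 ∈ G) → w' τ ≡ ΣSub (suc n) (λ S → wExt w τ S * (1ℤ - eS S x0))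
product-cremα {n} w w' prod τ ch c t dec x0 inn = begin
    w' τ
  ≡⟨ prod τ ch c t dec ⟩
    ΣFin (length τ) (λ i → c i * cremα (eS (L.lookup τ i))) - ΣSub (suc n) (λ S → wExt w τ S * cremα (eS S))
  ≡⟨ cong₂ _-_ E1 E2 ⟩
    (ΣFin (length τ) (λ i → c i * eS (L.lookup τ i) zero) - ΣFin (length τ) c) - (balSum w τ zero - ΣSub (suc n) (wExt w τ))
  ≡⟨ cong (λ z → (ΣFin (length τ) (λ i → c i * eS (L.lookup τ i) zero) - ΣFin (length τ) c) - (z - ΣSub (suc n) (wExt w τ))) (dec zero) ⟩
    (ΣFin (length τ) (λ i → c i * eS (L.lookup τ i) zero) - ΣFin (length τ) c) - ((ΣFin (length τ) (λ i → c i * eS (L.lookup τ i) zero) + t) - ΣSub (suc n) (wExt w τ))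
  ≡⟨ lem (ΣFin (length τ) (λ i → c i * eS (L.lookup τ i) zero)) (ΣFin (length τ) c) t (ΣSub (suc n) (wExt w τ)) ⟩
    ΣSub (suc n) (wExt w τ) - (ΣFin (length τ) c + t)
  ≡⟨ cong (λ z → ΣSub (suc n) (wExt w τ) - (z + t))
       (Σlist-cong (allFin (length τ)) (λ i → sym (trans (cong (c i *_) (eS-in (inn (∈-lookup i)))) (ℤP.*-identityʳ (c i))))) ⟩
    ΣSub (suc n) (wExt w τ) - (ΣFin (length τ) (λ i → c i * eS (L.lookup τ i) x0) + t)
  ≡⟨ cong (λ z → ΣSub (suc n) (wExt w τ) - z) (sym (dec x0)) ⟩
    ΣSub (suc n) (wExt w τ) - balSum w τ x0
  ≡⟨ sym (trans (ΣSub-cong (suc n) (λ S → lem2 (wExt w τ S) (eS S x0))) (ΣSub-- (suc n) (wExt w τ) (λ S → wExt w τ S * eS S x0))) ⟩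
    ΣSub (suc n) (λ S → wExt w τ S * (1ℤ - eS S x0)) ∎
  where
  lem : ∀ a b t s → (a - b) - ((a + t) - s) ≡ s - (b + t)
  lem = solve-∀
  lem2 : ∀ a e → a * (1ℤ - e) ≡ a - a * e
  lem2 = solve-∀
  E1 : ΣFin (length τ) (λ i → c i * cremα (eS (L.lookup τ i))) ≡ ΣFin (length τ) (λ i → c i * eS (L.lookup τ i) zero) - ΣFin (length τ) c
  E1 = trans (Σlist-cong (allFin (length τ)) (λ i → trans (cong (c i *_) (crem-eS (L.lookup τ i) (chain-np τ ch (∈-lookup i))))
                                                       (lem3 (c i) (eS (L.lookup τ i) zero))))
             (Σlist-- (λ i → c i * eS (L.lookup τ i) zero) c (allFin (length τ)))
    where lem3 : ∀ c e → c * (e - 1ℤ) ≡ c * e - c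
          lem3 = solve-∀
  E2 : ΣSub (suc n) (λ S → wExt w τ S * cremα (eS S)) ≡ balSum w τ zero - ΣSub (suc n) (wExt w τ)
  E2 = trans (ΣSub-cong (suc n) (wExt-crem w τ)) (ΣSub-- (suc n) (λ S → wExt w τ S * eS S zero) (wExt w τ))

-- v is d e_L + Σᵢ cᵢ e_{τᵢ} up to a multiple t of e_E, i.e. it represents a vector of span(L ∷ τ) in N.
InSpan : ∀ {m} → Subset m → List (Subset m) → (Fin m → ℤ) → Set
InSpan {m} L τ v = Σ ℤ λ d → Σ (Fin (length τ) → ℤ) λ c → Σ ℤ λ t →
  ∀ x → v x ≡ d * eS L x + ΣFin (length τ) (λ i → c i * eS (L.lookup τ i) x) + t

module Closure {m : ℕ} (M : Matroid m) where

  R : Subset m → ℕ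
  R = rk M

  Flat : Subset m → Set
  Flat F = T (isFlat M F)

  flat? : (F : Subset m) → Dec (Flat F)
  flat? F = T? (isFlat M F)

  R-cong : ∀ {A B} → A ⊆ B → B ⊆ A → R A ≡ R B
  R-cong ab ba = cong R (⊆-antisym ab ba)

  R-mono : ∀ {A B} → A ⊆ B → R A ≤ R B
  R-mono {A} {B} = rk-mono M A B

  R-∅ : R ∅ ≡ 0
  R-∅ = ℕP.n≤0⇒n≡0 (ℕP.≤-trans (rk-bounded M ∅) (ℕP.≤-reflexive (∣⊥∣≡0 m)))

  R-submod : ∀ A B → R (A ∪ B) ℕ.+ R (A ∩ B) ≤ R A ℕ.+ R B
  R-submod = rk-submod M

  R-single : ∀ x → R ⁅ x ⁆ ≤ 1
  R-single x = ℕP.≤-trans (rk-bounded M ⁅ x ⁆) (ℕP.≤-reflexive (∣⁅x⁆∣≡1 x))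

  R-∪⁅⁆-≤ : ∀ A x → R (A ∪ ⁅ x ⁆) ≤ suc (R A)
  R-∪⁅⁆-≤ A x = ℕP.≤-trans (ℕP.m≤m+n (R (A ∪ ⁅ x ⁆)) (R (A ∩ ⁅ x ⁆)))
    (ℕP.≤-trans (R-submod A ⁅ x ⁆) (ℕP.≤-trans (ℕP.+-monoʳ-≤ (R A) (R-single x)) (ℕP.≤-reflexive (ℕP.+-comm (R A) 1))))

  flat-out : ∀ {F x} → Flat F → x ∉ F → ¬ (R (F ∪ ⁅ x ⁆) ≡ R F)
  flat-out {F} {x} fl x∉ eq = go (allB-sound _ (allFin m) fl (∈-allFin x))
    where
    go : T (lookup F x ∨ not (R (F ∪ ⁅ x ⁆) ≡ᵇ R F)) → Empty
    go h rewrite ∉⇒lookup x∉ | eq with R F ≡ᵇ R F | ℕP.≡⇒≡ᵇ (R F) (R F) refl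
    ... | true | _ = h

  flat-in : ∀ {F} → (∀ x → x ∉ F → ¬ (R (F ∪ ⁅ x ⁆) ≡ R F)) → Flat F
  flat-in {F} h = allB-complete _ (allFin m) go
    where
    go : ∀ x → T (lookup F x ∨ not (R (F ∪ ⁅ x ⁆) ≡ᵇ R F))
    go x with lookup F x in eq
    ... | true = tt
    ... | false with R (F ∪ ⁅ x ⁆) ≡ᵇ R F in eq2
    ...   | false = tt
    ...   | true = h x (λ x∈ → case (trans (sym (∈⇒lookup x∈)) eq)) (ℕP.≡ᵇ⇒≡ _ _ (subst T (sym eq2) tt))
      where case : true ≡ false → Empty
            case ()

  flat-grow : ∀ {F x} → Flat F → x ∉ F → R F < R (F ∪ ⁅ x ⁆)
  flat-grow {F} {x} fl x∉ = ℕP.≤∧≢⇒< (R-mono (p⊆p∪q ⁅ x ⁆)) (λ e → flat-out fl x∉ (sym e))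

  cl : Subset m → Subset m
  cl A = tabulate (λ y → R (A ∪ ⁅ y ⁆) ≡ᵇ R A)

  cl-∈⁻ : ∀ {A y} → y ∈ cl A → R (A ∪ ⁅ y ⁆) ≡ R A
  cl-∈⁻ {A} {y} h = ℕP.≡ᵇ⇒≡ _ _ (subst T (sym (trans (sym (lookup∘tabulate _ y)) (∈⇒lookup h))) tt)

  cl-∈⁺ : ∀ {A y} → R (A ∪ ⁅ y ⁆) ≡ R A → y ∈ cl A
  cl-∈⁺ {A} {y} e = lookup⇒∈ (trans (lookup∘tabulate _ y) (go (ℕP.≡⇒≡ᵇ _ _ e)))
    where go : ∀ {b} → T b → b ≡ true
          go {true} _ = refl

  ∪-absorb : ∀ {A : Subset m} {y} → y ∈ A → A ∪ ⁅ y ⁆ ⊆ A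
  ∪-absorb {A} {y} y∈ z∈ with x∈p∪q⁻ A ⁅ y ⁆ z∈
  ... | inj₁ a = a
  ... | inj₂ b rewrite x∈⁅y⁆⇒x≡y y b = y∈

  ⊆-cl : ∀ {A} → A ⊆ cl A
  ⊆-cl {A} {y} y∈ = cl-∈⁺ (R-cong (∪-absorb y∈) (p⊆p∪q ⁅ y ⁆))

  private
    R-cl-bounded : ∀ k {A} B → ∣ B ∣ ≤ k → A ⊆ B → B ⊆ cl A → R B ≡ R A
    R-cl-bounded k {A} B sz A⊆B Bcl with B ⊆? A
    ... | yes BA = R-cong BA A⊆B
    ... | no nBA with ⊈-witness B A nBA
    ...   | y , y∈B , y∉A = go k sz
      where
      B' = B Sub.- y
      AB' : A ⊆ B'
      AB' {z} z∈ = x∈p∧x≢y⇒x∈p-y (A⊆B z∈) (λ e → y∉A (subst (_∈ A) e z∈))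
      small : ∣ B' ∣ ℕ.< ∣ B ∣
      small = x∈p⇒∣p-x∣<∣p∣ y∈B
      Bsplit : B ⊆ B' ∪ (A ∪ ⁅ y ⁆)
      Bsplit {z} z∈ with z FinP.≟ y
      ... | yes refl = q⊆p∪q B' (A ∪ ⁅ y ⁆) (q⊆p∪q A ⁅ y ⁆ (x∈⁅x⁆ y))
      ... | no z≢y = p⊆p∪q (A ∪ ⁅ y ⁆) (x∈p∧x≢y⇒x∈p-y z∈ z≢y)
      Ay : R (A ∪ ⁅ y ⁆) ≡ R A
      Ay = cl-∈⁻ (Bcl y∈B)
      Ainter : A ⊆ B' ∩ (A ∪ ⁅ y ⁆)
      Ainter z∈ = x∈p∩q⁺ (AB' z∈ , p⊆p∪q ⁅ y ⁆ z∈)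
      go : ∀ k → ∣ B ∣ ≤ k → R B ≡ R A
      go zero sz = ⊥-elim (ℕP.n≮0 (ℕP.≤-trans small sz))
      go (suc k) sz = ℕP.≤-antisym upper (R-mono A⊆B)
        where
        IH : R B' ≡ R A
        IH = R-cl-bounded k B' (ℕP.≤-pred (ℕP.≤-trans small sz)) AB' (λ z∈ → Bcl (p─q⊆p B ⁅ y ⁆ z∈))
        sub = R-submod B' (A ∪ ⁅ y ⁆)
        upper : R B ≤ R A
        upper = ℕP.+-cancelʳ-≤ (R A) (R B) (R A)
          (ℕP.≤-trans (ℕP.+-mono-≤ (R-mono Bsplit) (R-mono Ainter))
          (ℕP.≤-trans sub (ℕP.≤-reflexive (cong₂ ℕ._+_ IH Ay))))

  R-cl : ∀ A → R (cl A) ≡ R A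
  R-cl A = R-cl-bounded ∣ cl A ∣ (cl A) ℕP.≤-refl ⊆-cl (λ z → z)

  cl-flat : ∀ A → Flat (cl A)
  cl-flat A = flat-in go
    where
    go : ∀ x → x ∉ cl A → ¬ (R (cl A ∪ ⁅ x ⁆) ≡ R (cl A))
    go x x∉ e = ℕP.<-irrefl (trans (sym (R-cl A)) (sym e)) (ℕP.<-≤-trans lt mono)
      where
      ne : ¬ (R (A ∪ ⁅ x ⁆) ≡ R A)
      ne e' = x∉ (cl-∈⁺ e')
      lt : R A < R (A ∪ ⁅ x ⁆)
      lt = ℕP.≤∧≢⇒< (R-mono (p⊆p∪q ⁅ x ⁆)) (λ e' → ne (sym e'))
      case : ∀ {z} → z ∈ A ⊎ z ∈ ⁅ x ⁆ → z ∈ cl A ∪ ⁅ x ⁆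
      case (inj₁ a) = p⊆p∪q ⁅ x ⁆ (⊆-cl a)
      case (inj₂ b) = q⊆p∪q (cl A) ⁅ x ⁆ b
      mono : R (A ∪ ⁅ x ⁆) ≤ R (cl A ∪ ⁅ x ⁆)
      mono = R-mono (λ {z} z∈ → case (x∈p∪q⁻ A ⁅ x ⁆ z∈))

  cl-min : ∀ {A F} → A ⊆ F → Flat F → cl A ⊆ F
  cl-min {A} {F} AF fl {y} y∈ with y ∈? F
  ... | yes p = p
  ... | no y∉F = ⊥-elim (ℕP.<-irrefl refl (ℕP.<-≤-trans (flat-grow fl y∉F) le))
    where
    Ay : R (A ∪ ⁅ y ⁆) ≡ R A
    Ay = cl-∈⁻ y∈
    s1 : F ∪ ⁅ y ⁆ ⊆ F ∪ (A ∪ ⁅ y ⁆)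
    s1 {z} z∈ with x∈p∪q⁻ F ⁅ y ⁆ z∈
    ... | inj₁ a = p⊆p∪q (A ∪ ⁅ y ⁆) a
    ... | inj₂ b = q⊆p∪q F (A ∪ ⁅ y ⁆) (q⊆p∪q A ⁅ y ⁆ b)
    s2 : A ⊆ F ∩ (A ∪ ⁅ y ⁆)
    s2 z∈ = x∈p∩q⁺ (AF z∈ , p⊆p∪q ⁅ y ⁆ z∈)
    le : R (F ∪ ⁅ y ⁆) ≤ R F
    le = ℕP.+-cancelʳ-≤ (R A) _ _
      (ℕP.≤-trans (ℕP.+-mono-≤ (R-mono s1) (R-mono s2))
      (ℕP.≤-trans (R-submod F (A ∪ ⁅ y ⁆)) (ℕP.≤-reflexive (cong (R F ℕ.+_) Ay))))

  R-strictMono : ∀ {F G} → Flat F → F ⊂ G → R F < R G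
  R-strictMono {F} {G} fl (FG , y , y∈G , y∉F) = ℕP.<-≤-trans (flat-grow fl y∉F) (R-mono sub)
    where sub : F ∪ ⁅ y ⁆ ⊆ G
          sub {z} z∈ with x∈p∪q⁻ F ⁅ y ⁆ z∈
          ... | inj₁ a = FG a
          ... | inj₂ b rewrite x∈⁅y⁆⇒x≡y y b = y∈G

  flat-eq : ∀ {G F} → Flat G → G ⊆ F → R G ≡ R F → G ≡ F
  flat-eq {G} {F} fl GF e = ⊆-antisym GF FG
    where
    FG : F ⊆ G
    FG {z} z∈ with z ∈? G
    ... | yes p = p
    ... | no z∉ = ⊥-elim (ℕP.<-irrefl e (ℕP.<-≤-trans (flat-grow fl z∉) (R-mono sub)))
      where sub : G ∪ ⁅ z ⁆ ⊆ F
            sub {w} w∈ with x∈p∪q⁻ G ⁅ z ⁆ w∈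
            ... | inj₁ a = GF a
            ... | inj₂ b rewrite x∈⁅y⁆⇒x≡y z b = z∈

  R-cover : ∀ {F x} → Flat F → x ∉ F → R (cl (F ∪ ⁅ x ⁆)) ≡ suc (R F)
  R-cover {F} {x} fl x∉ = trans (R-cl _) (ℕP.≤-antisym (R-∪⁅⁆-≤ F x) (flat-grow fl x∉))

  ∈-cover : ∀ {F x} → x ∈ cl (F ∪ ⁅ x ⁆)
  ∈-cover {F} {x} = ⊆-cl (q⊆p∪q F ⁅ x ⁆ (x∈⁅x⁆ x))

  ⊆-cover : ∀ {F x} → F ⊆ cl (F ∪ ⁅ x ⁆)
  ⊆-cover {F} {x} z∈ = ⊆-cl (p⊆p∪q ⁅ x ⁆ z∈)

  cover-least : ∀ {F x S} → F ⊆ S → x ∈ S → Flat S → cl (F ∪ ⁅ x ⁆) ⊆ S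
  cover-least {F} {x} {S} FS x∈ fl = cl-min sub fl
    where sub : F ∪ ⁅ x ⁆ ⊆ S
          sub {z} z∈ with x∈p∪q⁻ F ⁅ x ⁆ z∈
          ... | inj₁ a = FS a
          ... | inj₂ b rewrite x∈⁅y⁆⇒x≡y x b = x∈

  cover-unique : ∀ {L x S} → Flat L → x ∉ L → Flat S → L ⊆ S → x ∈ S → R S ≡ suc (R L) →
                 S ≡ cl (L ∪ ⁅ x ⁆)
  cover-unique {L} {x} {S} flL x∉ flS LS x∈ e =
    sym (flat-eq (cl-flat _) (cover-least LS x∈ flS) (trans (R-cover flL x∉) (sym e)))

  R≤R-Full : ∀ A → R A ≤ R Full
  R≤R-Full A = R-mono (λ _ → ∈⊤)

  ∈⇒1≤R : ∀ {F x} → Simple M → x ∈ F → 1 ≤ R F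
  ∈⇒1≤R {F} {x} simple x∈ = ℕP.≤-trans (ℕP.≤-reflexive (sym (Simple.noLoops simple x))) (R-mono sub)
    where sub : ⁅ x ⁆ ⊆ F
          sub z∈ rewrite x∈⁅y⁆⇒x≡y x z∈ = x∈

  ∅-flat : Simple M → Flat ∅
  ∅-flat simple = flat-in λ x _ e → ℕP.<-irrefl (sym (trans e R-∅)) (∈⇒1≤R simple (q⊆p∪q ∅ ⁅ x ⁆ (x∈⁅x⁆ x)))

  R≡0⇒≡∅ : ∀ {F} → Simple M → R F ≡ 0 → F ≡ ∅
  R≡0⇒≡∅ {F} simple e = ⊆-antisym (λ {z} z∈ → ⊥-elim (ℕP.<-irrefl (sym e) (∈⇒1≤R simple z∈))) (λ z∈ → ⊥-elim (∉⊥ z∈))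

module Weisner {m : ℕ} (M : Matroid m) (μ : Subset m → ℤ) (mob : IsMobius M μ) where
  open Closure M

  mobius-sum : ∀ F → Flat F → ¬ (F ≡ ∅) → ΣSub m (λ G → ⟦ flat? G ×-dec G ⊆? F ⟧ * μ G) ≡ 0ℤ
  mobius-sum F fl ne = trans (ΣSub-cong m (λ G → sym (if-∧-does (isFlat M G) (G ⊆? F) (μ G))))
                         (IsMobius.mob-rec mob F fl ne)

  weisnerSum : Fin m → Subset m → ℤ
  weisnerSum x F = ΣSub m (λ G → ⟦ flat? G ×-dec G ⊆? F ×-dec cl (G ∪ ⁅ x ⁆) ≟S F ⟧ * μ G)

  ∈⇒≢∅ : ∀ {F : Subset m} {x} → x ∈ F → ¬ (F ≡ ∅)
  ∈⇒≢∅ x∈ refl = ∉⊥ x∈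

  -- Regroup the flats G ≤ F by the flat cl (G ∪ ⁅ x ⁆) that they span together with x.
  Σ-weisnerSum : ∀ x F → Flat F → x ∈ F →
    ΣSub m (λ H → ⟦ flat? H ×-dec x ∈? H ×-dec H ⊆? F ⟧ * weisnerSum x H) ≡ 0ℤ
  Σ-weisnerSum x F fl x∈ = begin
      ΣSub m (λ H → ⟦ flat? H ×-dec x ∈? H ×-dec H ⊆? F ⟧ * weisnerSum x H)
    ≡⟨ ΣSub-cong m (λ H → sym (ΣSub-* m ⟦ flat? H ×-dec x ∈? H ×-dec H ⊆? F ⟧ (λ G → ⟦ flat? G ×-dec G ⊆? H ×-dec cl (G ∪ ⁅ x ⁆) ≟S H ⟧ * μ G))) ⟩
      ΣSub m (λ H → ΣSub m (λ G → ⟦ flat? H ×-dec x ∈? H ×-dec H ⊆? F ⟧ * (⟦ flat? G ×-dec G ⊆? H ×-dec cl (G ∪ ⁅ x ⁆) ≟S H ⟧ * μ G)))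
    ≡⟨ ΣSub-swap m (λ H G → ⟦ flat? H ×-dec x ∈? H ×-dec H ⊆? F ⟧ * (⟦ flat? G ×-dec G ⊆? H ×-dec cl (G ∪ ⁅ x ⁆) ≟S H ⟧ * μ G)) ⟩
      ΣSub m (λ G → ΣSub m (λ H → ⟦ flat? H ×-dec x ∈? H ×-dec H ⊆? F ⟧ * (⟦ flat? G ×-dec G ⊆? H ×-dec cl (G ∪ ⁅ x ⁆) ≟S H ⟧ * μ G)))
    ≡⟨ ΣSub-cong m inner ⟩
      ΣSub m (λ G → ⟦ flat? G ×-dec G ⊆? F ⟧ * μ G)
    ≡⟨ mobius-sum F fl (∈⇒≢∅ x∈) ⟩
      0ℤ ∎
    where
    inner : ∀ G → ΣSub m (λ H → ⟦ flat? H ×-dec x ∈? H ×-dec H ⊆? F ⟧ * (⟦ flat? G ×-dec G ⊆? H ×-dec cl (G ∪ ⁅ x ⁆) ≟S H ⟧ * μ G))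
                  ≡ ⟦ flat? G ×-dec G ⊆? F ⟧ * μ G
    inner G = trans (ΣSub-single m _ H0 zero-else) value
      where
      H0 = cl (G ∪ ⁅ x ⁆)
      zero-else : ∀ H → ¬ (H ≡ H0) → ⟦ flat? H ×-dec x ∈? H ×-dec H ⊆? F ⟧ * (⟦ flat? G ×-dec G ⊆? H ×-dec cl (G ∪ ⁅ x ⁆) ≟S H ⟧ * μ G) ≡ 0ℤ
      zero-else H ne = trans (cong (⟦ flat? H ×-dec x ∈? H ×-dec H ⊆? F ⟧ *_)
                               (ind-mul-no (flat? G ×-dec G ⊆? H ×-dec cl (G ∪ ⁅ x ⁆) ≟S H) (μ G) (λ p → ne (sym (proj₂ (proj₂ p))))))
                             (ℤP.*-zeroʳ ⟦ flat? H ×-dec x ∈? H ×-dec H ⊆? F ⟧)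
      value : ⟦ flat? H0 ×-dec x ∈? H0 ×-dec H0 ⊆? F ⟧ * (⟦ flat? G ×-dec G ⊆? H0 ×-dec H0 ≟S H0 ⟧ * μ G) ≡ ⟦ flat? G ×-dec G ⊆? F ⟧ * μ G
      value with flat? G | G ⊆? F
      ... | no nf | _ = trans (cong (⟦ flat? H0 ×-dec x ∈? H0 ×-dec H0 ⊆? F ⟧ *_) (ℤP.*-zeroˡ (μ G))) (ℤP.*-zeroʳ ⟦ flat? H0 ×-dec x ∈? H0 ×-dec H0 ⊆? F ⟧)
      ... | yes fG | no nGF = ind-mul-no (flat? H0 ×-dec x ∈? H0 ×-dec H0 ⊆? F) (⟦ yes fG ×-dec G ⊆? H0 ×-dec H0 ≟S H0 ⟧ * μ G) (λ p → nGF (λ z∈ → proj₂ (proj₂ p) (⊆-cover z∈)))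
      ... | yes fG | yes GF = trans (cong₂ _*_ (⟦⟧-yes (flat? H0 ×-dec x ∈? H0 ×-dec H0 ⊆? F) (cl-flat _ , ∈-cover , cover-least GF x∈ fl))
                                              (cong (_* μ G) (⟦⟧-yes (yes fG ×-dec G ⊆? H0 ×-dec H0 ≟S H0) (fG , ⊆-cover , refl))))
                                     (ℤP.*-identityˡ _)

  weisnerSum-step : ∀ x F → Flat F → x ∈ F → (∀ H → H ⊂ F → Flat H → x ∈ H → weisnerSum x H ≡ 0ℤ) → weisnerSum x F ≡ 0ℤ
  weisnerSum-step x F fl x∈ rec = trans (sym single) (Σ-weisnerSum x F fl x∈)
    where
    term = λ H → ⟦ flat? H ×-dec x ∈? H ×-dec H ⊆? F ⟧ * weisnerSum x H
    others : ∀ H → ¬ (H ≡ F) → term H ≡ 0ℤ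
    others H ne with flat? H ×-dec x ∈? H ×-dec H ⊆? F
    ... | no _ = ℤP.*-zeroˡ (weisnerSum x H)
    ... | yes (fH , xH , HF) = cong (1ℤ *_) (rec H (⊆∧⊉⇒⊂ HF (λ FH → ne (⊆-antisym HF FH))) fH xH)
    single : ΣSub m term ≡ weisnerSum x F
    single = trans (ΣSub-single m term F others) (ind-mul-yes (flat? F ×-dec x ∈? F ×-dec F ⊆? F) _ (fl , x∈ , (λ z → z)))

  weisnerSum≡0 : ∀ x k F → ∣ F ∣ ≤ k → Flat F → x ∈ F → weisnerSum x F ≡ 0ℤ
  weisnerSum≡0 x zero F sz fl x∈ = weisnerSum-step x F fl x∈ λ H HsF _ _ → ⊥-elim (ℕP.n≮0 (ℕP.<-≤-trans (p⊂q⇒∣p∣<∣q∣ HsF) sz))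
  weisnerSum≡0 x (suc k) F sz fl x∈ = weisnerSum-step x F fl x∈ λ H HsF fH xH →
    weisnerSum≡0 x k H (ℕP.≤-pred (ℕP.<-≤-trans (p⊂q⇒∣p∣<∣q∣ HsF) sz)) fH xH

  HyperplaneMissing : Fin m → Subset m → Subset m → Set
  HyperplaneMissing x F G = Flat G × G ⊂ F × suc (R G) ≡ R F × x ∉ G

  hyperplaneMissing? : ∀ x F G → Dec (HyperplaneMissing x F G)
  hyperplaneMissing? x F G = flat? G ×-dec G ⊂? F ×-dec suc (R G) ℕP.≟ R F ×-dec ¬? (x ∈? G)

  weisner : ∀ x F → Flat F → x ∈ F →
    μ F + ΣSub m (λ G → ⟦ hyperplaneMissing? x F G ⟧ * μ G) ≡ 0ℤ
  weisner x F fl x∈ = begin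
      μ F + ΣSub m (λ G → ⟦ hyperplaneMissing? x F G ⟧ * μ G)
    ≡⟨ cong (_+ ΣSub m (λ G → ⟦ hyperplaneMissing? x F G ⟧ * μ G)) (sym (trans (ΣSub-single m (λ G → ⟦ G ≟S F ⟧ * μ G) F (λ G ne → ind-mul-no (G ≟S F) (μ G) ne)) (ind-mul-yes (F ≟S F) (μ F) refl))) ⟩
      ΣSub m (λ G → ⟦ G ≟S F ⟧ * μ G) + ΣSub m (λ G → ⟦ hyperplaneMissing? x F G ⟧ * μ G)
    ≡⟨ sym (ΣSub-+ m (λ G → ⟦ G ≟S F ⟧ * μ G) (λ G → ⟦ hyperplaneMissing? x F G ⟧ * μ G)) ⟩
      ΣSub m (λ G → ⟦ G ≟S F ⟧ * μ G + ⟦ hyperplaneMissing? x F G ⟧ * μ G)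
    ≡⟨ sym (ΣSub-cong m pw) ⟩
      weisnerSum x F
    ≡⟨ weisnerSum≡0 x ∣ F ∣ F ℕP.≤-refl fl x∈ ⟩
      0ℤ ∎
    where
    clFF : cl (F ∪ ⁅ x ⁆) ≡ F
    clFF = ⊆-antisym (cl-min (∪-absorb x∈) fl) ⊆-cover
    pw : ∀ G → ⟦ flat? G ×-dec G ⊆? F ×-dec cl (G ∪ ⁅ x ⁆) ≟S F ⟧ * μ G ≡ ⟦ G ≟S F ⟧ * μ G + ⟦ hyperplaneMissing? x F G ⟧ * μ G
    pw G with G ≟S F
    ... | yes refl = trans (ind-mul-yes (flat? G ×-dec G ⊆? G ×-dec cl (G ∪ ⁅ x ⁆) ≟S G) (μ G) (fl , (λ z → z) , clFF))
                     (sym (trans (cong (1ℤ * μ G +_) (ind-mul-no (hyperplaneMissing? x G G) (μ G) (λ p → ⊂-irref refl (proj₁ (proj₂ p)))))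
                                 (trans (ℤP.+-identityʳ _) (ℤP.*-identityˡ _))))
    ... | no ne = trans (cong (_* μ G) (⟦⟧-iff (flat? G ×-dec G ⊆? F ×-dec cl (G ∪ ⁅ x ⁆) ≟S F) (hyperplaneMissing? x F G) to from))
                        (sym (trans (cong (_+ ⟦ hyperplaneMissing? x F G ⟧ * μ G) (ℤP.*-zeroˡ (μ G))) (ℤP.+-identityˡ (⟦ hyperplaneMissing? x F G ⟧ * μ G))))
      where
      to : _ → _
      to (fG , GF , e) = fG , GsF , rkeq , x∉G
        where
        x∉G : x ∉ G
        x∉G x∈G = ne (⊆-antisym GF (subst (_⊆ G) e (cl-min (∪-absorb x∈G) fG)))
        GsF : G ⊂ F
        GsF = ⊆∧⊉⇒⊂ GF (λ FG → ne (⊆-antisym GF FG))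
        rkeq : suc (R G) ≡ R F
        rkeq = trans (sym (R-cover fG x∉G)) (cong R e)
      from : _ → _
      from (fG , GsF , rkeq , x∉G) = fG , proj₁ GsF ,
        flat-eq (cl-flat _) (cover-least (proj₁ GsF) x∈ fl) (trans (R-cover fG x∉G) rkeq)

module Flags {m : ℕ} (M : Matroid m) (μ : Subset m → ℤ) where
  open Closure M

  signedμ : Subset m → ℤ
  signedμ G = (-1ℤ ^ R G) * μ G

  Covers : ℕ → Subset m → Subset m → Set
  Covers lo L G = L ⊂ G × Flat G × R G ≡ suc lo

  covers? : ∀ lo L G → Dec (Covers lo L G)
  covers? lo L G = L ⊂? G ×-dec flat? G ×-dec R G ℕP.≟ suc lo

  Flag : ℕ → ℕ → Subset m → List (Subset m) → Set
  Flag lo hi L [] = lo ≡ hi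
  Flag lo hi L (G ∷ σ) = Covers lo L G × Flag (suc lo) hi G σ

  flag? : ∀ lo hi L σ → Dec (Flag lo hi L σ)
  flag? lo hi L [] = lo ℕP.≟ hi
  flag? lo hi L (G ∷ σ) = covers? lo L G ×-dec flag? (suc lo) hi G σ

  SkipFlag : ℕ → ℕ → Subset m → List (Subset m) → Set
  SkipFlag lo hi T τ = Flat T × R T ≡ suc (suc lo) × Flag (suc (suc lo)) hi T τ

  skipFlag? : ∀ lo hi T τ → Dec (SkipFlag lo hi T τ)
  skipFlag? lo hi T τ = flat? T ×-dec R T ℕP.≟ suc (suc lo) ×-dec flag? (suc (suc lo)) hi T τ

  headSignedμ : List (Subset m) → ℤ
  headSignedμ [] = 0ℤ
  headSignedμ (G ∷ _) = signedμ G

  flagWeight : ℕ → ℕ → List (Subset m) → ℤ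
  flagWeight lo hi σ = ⟦ flag? lo hi ∅ σ ⟧ * headSignedμ σ

  Flag⇒≤ : ∀ {lo hi L} σ → Flag lo hi L σ → lo ≤ hi
  Flag⇒≤ [] refl = ℕP.≤-refl
  Flag⇒≤ (G ∷ σ) (_ , g) = ℕP.≤-trans (ℕP.n≤1+n _) (Flag⇒≤ σ g)

  Flag-above : ∀ {lo hi L} σ → Flag lo hi L σ → ∀ {S} → S LM.∈ σ → L ⊂ S
  Flag-above (G ∷ σ) (st , g) (here refl) = proj₁ st
  Flag-above (G ∷ σ) (st , g) (there i) = ⊂-trans (proj₁ st) (Flag-above σ g i)

  nonemptyProper-intro : ∀ {L G} r → R Full ≡ suc r → L ⊂ G → R G ≤ r → T (nonemptyProper G)
  nonemptyProper-intro {L} {G} r rk LG le = ∧-intro (T-not-does (G ⊆? ∅) ne) (T-not-does (Full ⊆? G) np)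
    where
    ne : ¬ (G ⊆ ∅)
    ne h = ∉⊥ (h (proj₁ (proj₂ (proj₂ LG))))
    np : ¬ (Full ⊆ G)
    np h = ℕP.<-irrefl refl (ℕP.≤-trans (ℕP.≤-reflexive (sym rk)) (ℕP.≤-trans (R-mono h) le))

  Flag⇒isChain : ∀ {lo hi L} r → R Full ≡ suc r → hi ≤ r → ∀ σ → Flag lo hi L σ → T (isChain σ)
  Flag⇒isChain r rk hr [] g = tt
  Flag⇒isChain {lo} r rk hr (G ∷ []) (st , g) =
    nonemptyProper-intro r rk (proj₁ st) (ℕP.≤-trans (ℕP.≤-reflexive (proj₂ (proj₂ st))) (ℕP.≤-trans (Flag⇒≤ {L = G} [] g) hr))
  Flag⇒isChain {lo} r rk hr (G ∷ H ∷ σ) (st , g) =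
    ∧-intro (nonemptyProper-intro r rk (proj₁ st) (ℕP.≤-trans (ℕP.≤-reflexive (proj₂ (proj₂ st))) (ℕP.≤-trans (Flag⇒≤ (H ∷ σ) g) hr)))
            (∧-intro (T-does (G ⊂? H) (proj₁ (proj₁ g))) (Flag⇒isChain r rk hr (H ∷ σ) g))

  flag-insert : ∀ lo hi L S T τ (h : List (Subset m) → ℤ) →
    ⟦ flag? lo hi L (insertS S (T ∷ τ)) ⟧ * h (insertS S (T ∷ τ)) ≡
    ⟦ covers? lo L S ×-dec S ⊂? T ⟧ * (⟦ skipFlag? lo hi T τ ⟧ * h (S ∷ T ∷ τ)) +
    ⟦ covers? lo L T ⟧ * (⟦ flag? (suc lo) hi T (insertS S τ) ⟧ * h (T ∷ insertS S τ))
  flag-insert lo hi L S T τ h with S ⊆? T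
  ... | yes st =
    begin
      ⟦ flag? lo hi L (S ∷ T ∷ τ) ⟧ * h (S ∷ T ∷ τ)
    ≡⟨ cong (_* h (S ∷ T ∷ τ)) (trans (⟦⟧-iff (flag? lo hi L (S ∷ T ∷ τ)) ((covers? lo L S ×-dec S ⊂? T) ×-dec skipFlag? lo hi T τ)
           (λ { (a , (b , c , d) , e) → (a , b) , c , d , e }) (λ { ((a , b) , c , d , e) → a , (b , c , d) , e }))
           (⟦⟧-× (covers? lo L S ×-dec S ⊂? T) (skipFlag? lo hi T τ))) ⟩
      ⟦ covers? lo L S ×-dec S ⊂? T ⟧ * ⟦ skipFlag? lo hi T τ ⟧ * h (S ∷ T ∷ τ)
    ≡⟨ ℤP.*-assoc ⟦ covers? lo L S ×-dec S ⊂? T ⟧ ⟦ skipFlag? lo hi T τ ⟧ (h (S ∷ T ∷ τ)) ⟩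
      ⟦ covers? lo L S ×-dec S ⊂? T ⟧ * (⟦ skipFlag? lo hi T τ ⟧ * h (S ∷ T ∷ τ))
    ≡⟨ sym (ℤP.+-identityʳ _) ⟩
      ⟦ covers? lo L S ×-dec S ⊂? T ⟧ * (⟦ skipFlag? lo hi T τ ⟧ * h (S ∷ T ∷ τ)) + 0ℤ
    ≡⟨ cong (⟦ covers? lo L S ×-dec S ⊂? T ⟧ * (⟦ skipFlag? lo hi T τ ⟧ * h (S ∷ T ∷ τ)) +_)
         (sym (trans (cong (⟦ covers? lo L T ⟧ *_) (ind-mul-no (flag? (suc lo) hi T (insertS S τ)) (h (T ∷ insertS S τ)) bad))
                     (ℤP.*-zeroʳ ⟦ covers? lo L T ⟧))) ⟩
      ⟦ covers? lo L S ×-dec S ⊂? T ⟧ * (⟦ skipFlag? lo hi T τ ⟧ * h (S ∷ T ∷ τ)) +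
      ⟦ covers? lo L T ⟧ * (⟦ flag? (suc lo) hi T (insertS S τ) ⟧ * h (T ∷ insertS S τ)) ∎
    where
    bad : ¬ Flag (suc lo) hi T (insertS S τ)
    bad g = ⊂-irref refl (⊂-⊆-trans (Flag-above (insertS S τ) g (ins-mem S τ)) st)
  ... | no nst =
    begin
      ⟦ covers? lo L T ×-dec flag? (suc lo) hi T (insertS S τ) ⟧ * h (T ∷ insertS S τ)
    ≡⟨ cong (_* h (T ∷ insertS S τ)) (⟦⟧-× (covers? lo L T) (flag? (suc lo) hi T (insertS S τ))) ⟩
      ⟦ covers? lo L T ⟧ * ⟦ flag? (suc lo) hi T (insertS S τ) ⟧ * h (T ∷ insertS S τ)
    ≡⟨ ℤP.*-assoc ⟦ covers? lo L T ⟧ ⟦ flag? (suc lo) hi T (insertS S τ) ⟧ (h (T ∷ insertS S τ)) ⟩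
      ⟦ covers? lo L T ⟧ * (⟦ flag? (suc lo) hi T (insertS S τ) ⟧ * h (T ∷ insertS S τ))
    ≡⟨ sym (trans (cong (_+ ⟦ covers? lo L T ⟧ * (⟦ flag? (suc lo) hi T (insertS S τ) ⟧ * h (T ∷ insertS S τ)))
                     (ind-mul-no (covers? lo L S ×-dec S ⊂? T) (⟦ skipFlag? lo hi T τ ⟧ * h (S ∷ T ∷ τ)) (λ p → nst (proj₁ (proj₂ p)))))
               (ℤP.+-identityˡ _)) ⟩
      ⟦ covers? lo L S ×-dec S ⊂? T ⟧ * (⟦ skipFlag? lo hi T τ ⟧ * h (S ∷ T ∷ τ)) +
      ⟦ covers? lo L T ⟧ * (⟦ flag? (suc lo) hi T (insertS S τ) ⟧ * h (T ∷ insertS S τ)) ∎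

module ExtSums {m : ℕ} (M : Matroid m) (μ : Subset m → ℤ) (hi : ℕ) where
  open Closure M
  open Flags M μ

  flagExtSum : ℕ → Subset m → List (Subset m) → (Subset m → ℤ) → ℤ
  flagExtSum lo L τ ψ = ΣSub m (λ S → ⟦ flag? lo hi L (insertS S τ) ⟧ * ψ S)

  weightExtSum : ℕ → List (Subset m) → (Subset m → ℤ) → ℤ
  weightExtSum lo τ ψ = ΣSub m (λ S → flagWeight lo hi (insertS S τ) * ψ S)

  coverSum : ℕ → Subset m → Subset m → (Subset m → ℤ) → ℤ
  coverSum lo L T ψ = ΣSub m (λ S → ⟦ covers? lo L S ×-dec S ⊂? T ⟧ * ψ S)

  flagExtSum-∷ : ∀ lo L T τ ψ → flagExtSum lo L (T ∷ τ) ψ ≡ ⟦ skipFlag? lo hi T τ ⟧ * coverSum lo L T ψ + ⟦ covers? lo L T ⟧ * flagExtSum (suc lo) T τ ψ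
  flagExtSum-∷ lo L T τ ψ = begin
      flagExtSum lo L (T ∷ τ) ψ
    ≡⟨ ΣSub-cong m (λ S → flag-insert lo hi L S T τ (λ _ → ψ S)) ⟩
      ΣSub m (λ S → a S * (c * ψ S) + d * (b S * ψ S))
    ≡⟨ ΣSub-+ m (λ S → a S * (c * ψ S)) (λ S → d * (b S * ψ S)) ⟩
      ΣSub m (λ S → a S * (c * ψ S)) + ΣSub m (λ S → d * (b S * ψ S))
    ≡⟨ cong₂ _+_ (trans (ΣSub-cong m (λ S → x*yz≡y*xz (a S) c (ψ S))) (ΣSub-* m c (λ S → a S * ψ S)))
                 (ΣSub-* m d (λ S → b S * ψ S)) ⟩
      c * coverSum lo L T ψ + d * flagExtSum (suc lo) T τ ψ ∎
    where
    a = λ S → ⟦ covers? lo L S ×-dec S ⊂? T ⟧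
    b = λ S → ⟦ flag? (suc lo) hi T (insertS S τ) ⟧
    c = ⟦ skipFlag? lo hi T τ ⟧
    d = ⟦ covers? lo L T ⟧

  weightExtSum-∷ : ∀ lo T τ ψ → weightExtSum lo (T ∷ τ) ψ ≡ ⟦ skipFlag? lo hi T τ ⟧ * coverSum lo ∅ T (λ S → signedμ S * ψ S) + ⟦ covers? lo ∅ T ⟧ * (signedμ T * flagExtSum (suc lo) T τ ψ)
  weightExtSum-∷ lo T τ ψ = begin
      weightExtSum lo (T ∷ τ) ψ
    ≡⟨ ΣSub-cong m (λ S → trans (ℤP.*-assoc ⟦ flag? lo hi ∅ (insertS S (T ∷ τ)) ⟧ (headSignedμ (insertS S (T ∷ τ))) (ψ S))
                                 (flag-insert lo hi ∅ S T τ (λ σ → headSignedμ σ * ψ S))) ⟩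
      ΣSub m (λ S → a S * (c * (signedμ S * ψ S)) + d * (b S * (signedμ T * ψ S)))
    ≡⟨ ΣSub-+ m (λ S → a S * (c * (signedμ S * ψ S))) (λ S → d * (b S * (signedμ T * ψ S))) ⟩
      ΣSub m (λ S → a S * (c * (signedμ S * ψ S))) + ΣSub m (λ S → d * (b S * (signedμ T * ψ S)))
    ≡⟨ cong₂ _+_ (trans (ΣSub-cong m (λ S → x*yz≡y*xz (a S) c (signedμ S * ψ S))) (ΣSub-* m c (λ S → a S * (signedμ S * ψ S))))
                 (trans (ΣSub-* m d (λ S → b S * (signedμ T * ψ S)))
                   (cong (d *_) (trans (ΣSub-cong m (λ S → x*yz≡y*xz (b S) (signedμ T) (ψ S))) (ΣSub-* m (signedμ T) (λ S → b S * ψ S))))) ⟩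
      c * coverSum lo ∅ T (λ S → signedμ S * ψ S) + d * (signedμ T * flagExtSum (suc lo) T τ ψ) ∎
    where
    a = λ S → ⟦ covers? lo ∅ S ×-dec S ⊂? T ⟧
    b = λ S → ⟦ flag? (suc lo) hi T (insertS S τ) ⟧
    c = ⟦ skipFlag? lo hi T τ ⟧
    d = ⟦ covers? lo ∅ T ⟧

  weightExtSum-[] : ∀ lo ψ → weightExtSum lo [] ψ ≡ ΣSub m (λ S → ⟦ covers? lo ∅ S ×-dec suc lo ℕP.≟ hi ⟧ * (signedμ S * ψ S))
  weightExtSum-[] lo ψ = ΣSub-cong m (λ S → ℤP.*-assoc ⟦ covers? lo ∅ S ×-dec suc lo ℕP.≟ hi ⟧ (signedμ S) (ψ S))

  cover-covers : ∀ {lo L x} → Flat L → R L ≡ lo → x ∉ L → Covers lo L (cl (L ∪ ⁅ x ⁆))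
  cover-covers {lo} {L} {x} fl rl x∉ =
    ⊆∧⊉⇒⊂ ⊆-cover (λ h → x∉ (h ∈-cover)) , cl-flat _ , trans (R-cover fl x∉) (cong suc rl)

  covers-unique : ∀ {lo L x S} → Flat L → R L ≡ lo → x ∉ L → Covers lo L S → x ∈ S → S ≡ cl (L ∪ ⁅ x ⁆)
  covers-unique {lo} {L} {x} {S} fl rl x∉ (LS , fS , rS) x∈ = cover-unique fl x∉ fS (proj₁ LS) x∈ (trans rS (cong suc (sym rl)))

  private
    comb : ∀ dA eL cA eT d' S t' → (dA * eL + cA * eT) + (d' * eT + S + t') ≡ dA * eL + ((cA + d') * eT + S) + t'
    comb = solve-∀
    r1 : ∀ N → N ≡ (N - 1ℤ) * 1ℤ + 0ℤ + 1ℤ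
    r1 = solve-∀
    r2 : ∀ N → 1ℤ ≡ (N - 1ℤ) * 0ℤ + 0ℤ + 1ℤ
    r2 = solve-∀
    r3 : ∀ e → 0ℤ ≡ 0ℤ * e + 0ℤ + 0ℤ
    r3 = solve-∀
    r4 : ∀ N → N ≡ (N - 1ℤ) * 1ℤ + 1ℤ * 1ℤ
    r4 = solve-∀
    r5 : ∀ N → 1ℤ ≡ (N - 1ℤ) * 0ℤ + 1ℤ * 1ℤ
    r5 = solve-∀
    r6 : ∀ N → 0ℤ ≡ (N - 1ℤ) * 0ℤ + 1ℤ * 0ℤ
    r6 = solve-∀
    r7 : ∀ a b → 0ℤ ≡ 0ℤ * a + 0ℤ * b
    r7 = solve-∀

  flagExtSum-[]-inSpan : ∀ lo L → Flat L → R L ≡ lo → (d : Dec (suc lo ≡ hi)) →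
    InSpan L [] (λ x → ΣSub m (λ S → ⟦ covers? lo L S ×-dec d ⟧ * eS S x))
  flagExtSum-[]-inSpan lo L fl rl (no ne) = 0ℤ , (λ ()) , 0ℤ , λ x →
    trans (ΣSub-0 m (λ S → ind-mul-no (covers? lo L S ×-dec no ne) (eS S x) (λ p → ne (proj₂ p)))) (r3 (eS L x))
  flagExtSum-[]-inSpan lo L fl rl (yes e) = N - 1ℤ , (λ ()) , 1ℤ , val
    where
    N = ΣSub m (λ S → ⟦ covers? lo L S ⟧)
    val : ∀ x → ΣSub m (λ S → ⟦ covers? lo L S ×-dec yes e ⟧ * eS S x) ≡ (N - 1ℤ) * eS L x + 0ℤ + 1ℤ
    val x with x ∈? L
    ... | yes x∈ = trans (ΣSub-cong m pw) (trans (r1 N) (cong (λ z → (N - 1ℤ) * z + 0ℤ + 1ℤ) (sym (eS-in x∈))))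
      where
      pw : ∀ S → ⟦ covers? lo L S ×-dec yes e ⟧ * eS S x ≡ ⟦ covers? lo L S ⟧
      pw S with covers? lo L S
      ... | yes st = trans (ℤP.*-identityˡ (eS S x)) (eS-in (proj₁ (proj₁ st) x∈))
      ... | no _ = ℤP.*-zeroˡ (eS S x)
    ... | no x∉ = trans (ΣSub-single m _ S0 others) (trans v0 (trans (r2 N) (cong (λ z → (N - 1ℤ) * z + 0ℤ + 1ℤ) (sym (eS-out x∉)))))
      where
      S0 = cl (L ∪ ⁅ x ⁆)
      others : ∀ S → ¬ (S ≡ S0) → ⟦ covers? lo L S ×-dec yes e ⟧ * eS S x ≡ 0ℤ
      others S ne with covers? lo L S
      ... | no _ = ℤP.*-zeroˡ (eS S x)
      ... | yes st with x ∈? S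
      ...   | yes x∈S = ⊥-elim (ne (covers-unique fl rl x∉ st x∈S))
      ...   | no x∉S = trans (ℤP.*-identityˡ (eS S x)) (eS-out x∉S)
      v0 : ⟦ covers? lo L S0 ×-dec yes e ⟧ * eS S0 x ≡ 1ℤ
      v0 = trans (ind-mul-yes (covers? lo L S0 ×-dec yes e) (eS S0 x) (cover-covers fl rl x∉ , e)) (eS-in ∈-cover)

  coverSum-inSpan : ∀ lo L T τ → Flat L → R L ≡ lo → Σ ℤ λ dA → Σ ℤ λ cA →
    ∀ x → ⟦ skipFlag? lo hi T τ ⟧ * coverSum lo L T (λ S → eS S x) ≡ dA * eS L x + cA * eS T x
  coverSum-inSpan lo L T τ fl rl with skipFlag? lo hi T τ
  ... | no _ = 0ℤ , 0ℤ , λ x → trans (ℤP.*-zeroˡ (coverSum lo L T (λ S → eS S x))) (r7 (eS L x) (eS T x))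
  ... | yes (fT , rT , _) with L ⊆? T
  ...   | no nLT = 0ℤ , 0ℤ , λ x → trans (ℤP.*-identityˡ _) (trans (ΣSub-0 m (λ S → ind-mul-no (covers? lo L S ×-dec S ⊂? T) (eS S x)
                      (λ p → nLT (⊆-trans (proj₁ (proj₁ (proj₁ p))) (proj₁ (proj₂ p)))))) (r7 (eS L x) (eS T x)))
  ...   | yes LT = NT - 1ℤ , 1ℤ , λ x → trans (ℤP.*-identityˡ _) (val x)
    where
    NT = coverSum lo L T (λ _ → 1ℤ)
    val : ∀ x → coverSum lo L T (λ S → eS S x) ≡ (NT - 1ℤ) * eS L x + 1ℤ * eS T x
    val x with x ∈? L
    ... | yes x∈L = trans (ΣSub-cong m pw) (trans (r4 NT) (cong₂ (λ a b → (NT - 1ℤ) * a + 1ℤ * b) (sym (eS-in x∈L)) (sym (eS-in (LT x∈L)))))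
      where
      pw : ∀ S → ⟦ covers? lo L S ×-dec S ⊂? T ⟧ * eS S x ≡ ⟦ covers? lo L S ×-dec S ⊂? T ⟧ * 1ℤ
      pw S with covers? lo L S ×-dec S ⊂? T
      ... | yes (st , _) = cong (1ℤ *_) (eS-in (proj₁ (proj₁ st) x∈L))
      ... | no _ = refl
    ... | no x∉L with x ∈? T
    ...   | yes x∈T = trans (ΣSub-single m _ S0 others) (trans v0 (trans (r5 NT) (cong₂ (λ a b → (NT - 1ℤ) * a + 1ℤ * b) (sym (eS-out x∉L)) (sym (eS-in x∈T)))))
      where
      S0 = cl (L ∪ ⁅ x ⁆)
      others : ∀ S → ¬ (S ≡ S0) → ⟦ covers? lo L S ×-dec S ⊂? T ⟧ * eS S x ≡ 0ℤ
      others S ne with covers? lo L S ×-dec S ⊂? T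
      ... | no _ = ℤP.*-zeroˡ (eS S x)
      ... | yes (st , _) with x ∈? S
      ...   | yes x∈S = ⊥-elim (ne (covers-unique fl rl x∉L st x∈S))
      ...   | no x∉S = trans (ℤP.*-identityˡ (eS S x)) (eS-out x∉S)
      S0T : S0 ⊂ T
      S0T = ⊆∧⊉⇒⊂ (cover-least LT x∈T fT) (λ TS → ℕP.<-irrefl refl (ℕP.<-≤-trans
              (ℕP.≤-reflexive (trans (cong suc (trans (R-cover fl x∉L) (cong suc rl))) (sym rT))) (R-mono TS)))
      v0 : ⟦ covers? lo L S0 ×-dec S0 ⊂? T ⟧ * eS S0 x ≡ 1ℤ
      v0 = trans (ind-mul-yes (covers? lo L S0 ×-dec S0 ⊂? T) (eS S0 x) (cover-covers fl rl x∉L , S0T)) (eS-in ∈-cover)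
    ...   | no x∉T = trans (ΣSub-0 m pw) (trans (r6 NT) (cong₂ (λ a b → (NT - 1ℤ) * a + 1ℤ * b) (sym (eS-out x∉L)) (sym (eS-out x∉T))))
      where
      pw : ∀ S → ⟦ covers? lo L S ×-dec S ⊂? T ⟧ * eS S x ≡ 0ℤ
      pw S with covers? lo L S ×-dec S ⊂? T
      ... | yes (_ , ST) = trans (ℤP.*-identityˡ (eS S x)) (eS-out (λ x∈S → x∉T (proj₁ ST x∈S)))
      ... | no _ = ℤP.*-zeroˡ (eS S x)

  flagExtSum-inSpan : ∀ τ lo L → Flat L → R L ≡ lo → InSpan L τ (λ x → flagExtSum lo L τ (λ S → eS S x))
  flagExtSum-inSpan [] lo L fl rl = flagExtSum-[]-inSpan lo L fl rl (suc lo ℕP.≟ hi)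
  flagExtSum-inSpan (T ∷ τ) lo L fl rl with coverSum-inSpan lo L T τ fl rl | DB
    where
    DB : Σ ℤ λ d' → Σ (Fin (length τ) → ℤ) λ c' → Σ ℤ λ t' → ∀ x →
         ⟦ covers? lo L T ⟧ * flagExtSum (suc lo) T τ (λ S → eS S x) ≡ d' * eS T x + ΣFin (length τ) (λ i → c' i * eS (L.lookup τ i) x) + t'
    DB with covers? lo L T
    ... | yes (_ , fT , rT) with flagExtSum-inSpan τ (suc lo) T fT rT
    ...   | d' , c' , t' , h = d' , c' , t' , λ x → trans (ℤP.*-identityˡ _) (h x)
    DB | no _ = 0ℤ , (λ _ → 0ℤ) , 0ℤ , λ x → trans (ℤP.*-zeroˡ (flagExtSum (suc lo) T τ (λ S → eS S x)))
             (sym (trans (cong (λ z → 0ℤ * eS T x + z + 0ℤ) (ΣFin-0 (length τ) (λ i → 0ℤ * eS (L.lookup τ i) x) (λ i → ℤP.*-zeroˡ (eS (L.lookup τ i) x))))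
                   (solve0 (eS T x))))
      where solve0 : ∀ e → 0ℤ * e + 0ℤ + 0ℤ ≡ 0ℤ
            solve0 = solve-∀
  ... | dA , cA , hA | d' , c' , t' , hB = dA , c , t' , λ x → begin
      flagExtSum lo L (T ∷ τ) (λ S → eS S x)
    ≡⟨ flagExtSum-∷ lo L T τ (λ S → eS S x) ⟩
      ⟦ skipFlag? lo hi T τ ⟧ * coverSum lo L T (λ S → eS S x) + ⟦ covers? lo L T ⟧ * flagExtSum (suc lo) T τ (λ S → eS S x)
    ≡⟨ cong₂ _+_ (hA x) (hB x) ⟩
      (dA * eS L x + cA * eS T x) + (d' * eS T x + ΣFin (length τ) (λ i → c' i * eS (L.lookup τ i) x) + t')
    ≡⟨ comb dA (eS L x) cA (eS T x) d' (ΣFin (length τ) (λ i → c' i * eS (L.lookup τ i) x)) t' ⟩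
      dA * eS L x + ((cA + d') * eS T x + ΣFin (length τ) (λ i → c' i * eS (L.lookup τ i) x)) + t'
    ≡⟨ cong (λ z → dA * eS L x + z + t') (sym (ΣFin-suc (length τ) (λ i → c i * eS (L.lookup (T ∷ τ) i) x))) ⟩
      dA * eS L x + ΣFin (length (T ∷ τ)) (λ i → c i * eS (L.lookup (T ∷ τ) i) x) + t' ∎
    where
    c : Fin (suc (length τ)) → ℤ
    c zero = cA + d'
    c (suc i) = c' i

module Whitney {m : ℕ} (M : Matroid m) (simple : Simple M) (μ : Subset m → ℤ) (mob : IsMobius M μ) where
  open Closure M
  open Weisner M μ mob

  whitney : ℕ → ℤ
  whitney d = ΣSub m (λ F → ⟦ flat? F ×-dec R F ℕP.≟ d ⟧ * μ F)

  whitneyWith : Fin m → ℕ → ℤ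
  whitneyWith x d = ΣSub m (λ S → ⟦ flat? S ×-dec R S ℕP.≟ d ⟧ * (μ S * eS S x))

  whitneyWithout : Fin m → ℕ → ℤ
  whitneyWithout x d = ΣSub m (λ S → ⟦ flat? S ×-dec R S ℕP.≟ d ⟧ * (μ S * (1ℤ - eS S x)))

  whitneyWith+whitneyWithout : ∀ x d → whitneyWith x d + whitneyWithout x d ≡ whitney d
  whitneyWith+whitneyWithout x d = trans (sym (ΣSub-+ m _ _)) (ΣSub-cong m (λ S → lem ⟦ flat? S ×-dec R S ℕP.≟ d ⟧ (μ S) (eS S x)))
    where lem : ∀ i u e → i * (u * e) + i * (u * (1ℤ - e)) ≡ i * u
          lem = solve-∀

  whitneyWith-0 : ∀ x → whitneyWith x 0 ≡ 0ℤ
  whitneyWith-0 x = ΣSub-0 m pw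
    where
    pw : ∀ S → ⟦ flat? S ×-dec R S ℕP.≟ 0 ⟧ * (μ S * eS S x) ≡ 0ℤ
    pw S with flat? S ×-dec R S ℕP.≟ 0
    ... | no _ = ℤP.*-zeroˡ (μ S * eS S x)
    ... | yes (fS , r0) rewrite R≡0⇒≡∅ simple r0 | eS-out {S = ∅} {x} ∉⊥ = trans (ℤP.*-identityˡ _) (ℤP.*-zeroʳ (μ ∅))

  flatOfRankContaining? : ∀ x d S → Dec ((Flat S × R S ≡ suc d) × x ∈ S)
  flatOfRankContaining? x d S = (flat? S ×-dec R S ℕP.≟ suc d) ×-dec x ∈? S

  weisner-flatsContaining : ∀ x d S → ⟦ flat? S ×-dec R S ℕP.≟ suc d ⟧ * (μ S * eS S x) ≡ - ΣSub m (λ G → ⟦ flatOfRankContaining? x d S ⟧ * (⟦ hyperplaneMissing? x S G ⟧ * μ G))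
  weisner-flatsContaining x d S with x ∈? S
  ... | no x∉ = trans (cong (λ z → ⟦ flat? S ×-dec R S ℕP.≟ suc d ⟧ * (μ S * z)) (eS-out x∉))
               (trans (trans (cong (⟦ flat? S ×-dec R S ℕP.≟ suc d ⟧ *_) (ℤP.*-zeroʳ (μ S))) (ℤP.*-zeroʳ ⟦ flat? S ×-dec R S ℕP.≟ suc d ⟧))
                 (sym (cong -_ (ΣSub-0 m (λ G → ind-mul-no ((flat? S ×-dec R S ℕP.≟ suc d) ×-dec no x∉) (⟦ hyperplaneMissing? x S G ⟧ * μ G) (λ p → x∉ (proj₂ p)))))))
  ... | yes x∈ with flat? S ×-dec R S ℕP.≟ suc d
  ...   | no _ = sym (cong -_ (ΣSub-0 m (λ G → ℤP.*-zeroˡ (⟦ hyperplaneMissing? x S G ⟧ * μ G))))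
  ...   | yes (fS , _) = trans (cong (λ z → 1ℤ * (μ S * z)) (eS-in x∈))
                         (trans (trans (ℤP.*-identityˡ _) (ℤP.*-identityʳ (μ S)))
                           (trans (+≡0⇒a≡-b _ _ (weisner x S fS x∈))
                             (cong -_ (ΣSub-cong m (λ G → sym (ℤP.*-identityˡ _))))))
  coversContaining-unique : ∀ x d G → ΣSub m (λ S → ⟦ flatOfRankContaining? x d S ⟧ * (⟦ hyperplaneMissing? x S G ⟧ * μ G)) ≡ ⟦ (flat? G ×-dec R G ℕP.≟ d) ×-dec ¬? (x ∈? G) ⟧ * μ G
  coversContaining-unique x d G = trans (ΣSub-single m _ S0 others) value
    where
    S0 = cl (G ∪ ⁅ x ⁆)
    others : ∀ S → ¬ (S ≡ S0) → ⟦ flatOfRankContaining? x d S ⟧ * (⟦ hyperplaneMissing? x S G ⟧ * μ G) ≡ 0ℤ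
    others S ne with flatOfRankContaining? x d S | hyperplaneMissing? x S G
    ... | no _ | _ = ℤP.*-zeroˡ (⟦ hyperplaneMissing? x S G ⟧ * μ G)
    ... | yes _ | no _ = cong (1ℤ *_) (ℤP.*-zeroˡ (μ G))
    ... | yes ((fS , rS) , x∈S) | yes (fG , GS , e , x∉G) =
          ⊥-elim (ne (cover-unique fG x∉G fS (proj₁ GS) x∈S (sym e)))
    value : ⟦ flatOfRankContaining? x d S0 ⟧ * (⟦ hyperplaneMissing? x S0 G ⟧ * μ G) ≡ ⟦ (flat? G ×-dec R G ℕP.≟ d) ×-dec ¬? (x ∈? G) ⟧ * μ G
    value = trans (sym (ℤP.*-assoc ⟦ flatOfRankContaining? x d S0 ⟧ ⟦ hyperplaneMissing? x S0 G ⟧ (μ G)))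
            (cong (_* μ G) (trans (sym (⟦⟧-× (flatOfRankContaining? x d S0) (hyperplaneMissing? x S0 G)))
              (⟦⟧-iff (flatOfRankContaining? x d S0 ×-dec hyperplaneMissing? x S0 G) ((flat? G ×-dec R G ℕP.≟ d) ×-dec ¬? (x ∈? G)) to from)))
      where
      to : _ → _
      to (((fS , rS) , x∈S) , (fG , GS , e , x∉G)) = (fG , ℕP.suc-injective (trans e rS)) , x∉G
      from : _ → _
      from ((fG , rG) , x∉G) = ((cl-flat _ , trans (R-cover fG x∉G) (cong suc rG)) , ∈-cover) ,
        (fG , ⊆∧⊉⇒⊂ ⊆-cover (λ h → x∉G (h ∈-cover)) , sym (R-cover fG x∉G) , x∉G)
  missing-indicator : ∀ x d G → ⟦ (flat? G ×-dec R G ℕP.≟ d) ×-dec ¬? (x ∈? G) ⟧ * μ G ≡ ⟦ flat? G ×-dec R G ℕP.≟ d ⟧ * (μ G * (1ℤ - eS G x))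
  missing-indicator x d G with x ∈? G | flat? G ×-dec R G ℕP.≟ d
  ... | yes x∈ | yes _ = trans (ℤP.*-zeroˡ (μ G)) (sym (trans (cong (λ z → 1ℤ * (μ G * (1ℤ - z))) (eS-in x∈)) (solve0 (μ G))))
    where solve0 : ∀ u → 1ℤ * (u * (1ℤ - 1ℤ)) ≡ 0ℤ
          solve0 = solve-∀
  ... | yes x∈ | no _ = trans (ℤP.*-zeroˡ (μ G)) (sym (ℤP.*-zeroˡ (μ G * (1ℤ - eS G x))))
  ... | no x∉ | yes _ = sym (trans (cong (λ z → 1ℤ * (μ G * (1ℤ - z))) (eS-out x∉)) (solve1 (μ G)))
    where solve1 : ∀ u → 1ℤ * (u * (1ℤ - 0ℤ)) ≡ 1ℤ * u
          solve1 = solve-∀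
  ... | no x∉ | no _ = trans (ℤP.*-zeroˡ (μ G)) (sym (ℤP.*-zeroˡ (μ G * (1ℤ - eS G x))))

  whitneyWith-suc : ∀ x d → whitneyWith x (suc d) ≡ - whitneyWithout x d
  whitneyWith-suc x d = begin
      whitneyWith x (suc d)
    ≡⟨ ΣSub-cong m (weisner-flatsContaining x d) ⟩
      ΣSub m (λ S → - ΣSub m (λ G → ⟦ flatOfRankContaining? x d S ⟧ * (⟦ hyperplaneMissing? x S G ⟧ * μ G)))
    ≡⟨ Σlist-neg (λ S → ΣSub m (λ G → ⟦ flatOfRankContaining? x d S ⟧ * (⟦ hyperplaneMissing? x S G ⟧ * μ G))) (allSubsets m) ⟩
      - ΣSub m (λ S → ΣSub m (λ G → ⟦ flatOfRankContaining? x d S ⟧ * (⟦ hyperplaneMissing? x S G ⟧ * μ G)))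
    ≡⟨ cong -_ (ΣSub-swap m (λ S G → ⟦ flatOfRankContaining? x d S ⟧ * (⟦ hyperplaneMissing? x S G ⟧ * μ G))) ⟩
      - ΣSub m (λ G → ΣSub m (λ S → ⟦ flatOfRankContaining? x d S ⟧ * (⟦ hyperplaneMissing? x S G ⟧ * μ G)))
    ≡⟨ cong -_ (ΣSub-cong m (coversContaining-unique x d)) ⟩
      - ΣSub m (λ G → ⟦ (flat? G ×-dec R G ℕP.≟ d) ×-dec ¬? (x ∈? G) ⟧ * μ G)
    ≡⟨ cong -_ (ΣSub-cong m (missing-indicator x d)) ⟩
      - whitneyWithout x d ∎

  complement-step : ∀ A B C S → A + B ≡ C → A ≡ - S → B ≡ S + C
  complement-step A B C S e1 e2 rewrite e2 = trans (sym (l1 S B)) (trans (cong (_+ S) e1) (ℤP.+-comm C S))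
    where l1 : ∀ S B → (- S + B) + S ≡ B
          l1 = solve-∀

  whitneyWith≡-Σwhitney : ∀ x d → whitneyWith x (suc d) ≡ - Σupto d whitney
  whitneyWith≡-Σwhitney x zero = trans (whitneyWith-suc x 0) (cong -_ (trans (complement-step (whitneyWith x 0) (whitneyWithout x 0) (whitney 0) 0ℤ (whitneyWith+whitneyWithout x 0) (whitneyWith-0 x)) (ℤP.+-identityˡ (whitney 0))))
  whitneyWith≡-Σwhitney x (suc d) = trans (whitneyWith-suc x (suc d)) (cong -_ (complement-step (whitneyWith x (suc d)) (whitneyWithout x (suc d)) (whitney (suc d)) (Σupto d whitney) (whitneyWith+whitneyWithout x (suc d)) (whitneyWith≡-Σwhitney x d)))

module TopWeights {m : ℕ} (M : Matroid m) (simple : Simple M) (μ : Subset m → ℤ) (mob : IsMobius M μ) (hi : ℕ) where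
  open Closure M
  open Weisner M μ mob
  open Flags M μ
  open ExtSums M μ hi
  open Whitney M simple μ mob

  R≡suc⇒∅⊂ : ∀ {S k} → R S ≡ suc k → ∅ ⊂ S
  R≡suc⇒∅⊂ {S} {k} e = ⊆∧⊉⇒⊂ (λ z → ⊥-elim (∉⊥ z)) (λ S⊆∅ → ℕP.<-irrefl refl
                   (ℕP.<-≤-trans (ℕP.≤-trans (s≤s z≤n) (ℕP.≤-reflexive (sym e))) (ℕP.≤-trans (R-mono S⊆∅) (ℕP.≤-reflexive R-∅))))

  coverSum-missing : ∀ lo T x → Flat T → R T ≡ suc (suc lo) → x ∈ T → coverSum lo ∅ T (λ S → signedμ S * (1ℤ - eS S x)) ≡ signedμ T
  coverSum-missing lo T x fT rT x∈T = begin
      coverSum lo ∅ T (λ S → signedμ S * (1ℤ - eS S x))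
    ≡⟨ ΣSub-cong m (λ S → go S (x ∈? S) (covers? lo ∅ S ×-dec S ⊂? T) (hyperplaneMissing? x T S)) ⟩
      ΣSub m (λ S → p * (⟦ hyperplaneMissing? x T S ⟧ * μ S))
    ≡⟨ ΣSub-* m p (λ S → ⟦ hyperplaneMissing? x T S ⟧ * μ S) ⟩
      p * ΣSub m (λ S → ⟦ hyperplaneMissing? x T S ⟧ * μ S)
    ≡⟨ cong (p *_) (+≡0⇒b≡-a _ _ (weisner x T fT x∈T)) ⟩
      p * (- μ T)
    ≡⟨ fin p (μ T) ⟩
      (-1ℤ * p) * μ T
    ≡⟨ cong (λ z → (-1ℤ ^ z) * μ T) (sym rT) ⟩
      signedμ T ∎
    where
    p = -1ℤ ^ suc lo
    fin : ∀ p u → p * (- u) ≡ (-1ℤ * p) * u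
    fin = solve-∀
    z1 : ∀ i w p u → i * (w * (1ℤ - 1ℤ)) ≡ p * (0ℤ * u)
    z1 = solve-∀
    z2 : ∀ p u → 1ℤ * ((p * u) * (1ℤ - 0ℤ)) ≡ p * (1ℤ * u)
    z2 = solve-∀
    z3 : ∀ w p u → 0ℤ * (w * (1ℤ - 0ℤ)) ≡ p * (0ℤ * u)
    z3 = solve-∀
    go : ∀ S → Dec (x ∈ S) → (d1 : Dec (Covers lo ∅ S × S ⊂ T)) → (d2 : Dec (HyperplaneMissing x T S)) →
         ⟦ d1 ⟧ * (signedμ S * (1ℤ - eS S x)) ≡ p * (⟦ d2 ⟧ * μ S)
    go S (yes x∈S) d1 (yes w) = ⊥-elim (proj₂ (proj₂ (proj₂ w)) x∈S)
    go S (yes x∈S) d1 (no _) rewrite eS-in {S = S} {x} x∈S = z1 ⟦ d1 ⟧ (signedμ S) p (μ S)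
    go S (no x∉) (yes ((_ , fS , rS) , ST)) (yes w) rewrite eS-out {S = S} {x} x∉ | rS = z2 p (μ S)
    go S (no x∉) (yes ((_ , fS , rS) , ST)) (no nw) = ⊥-elim (nw (fS , ST , trans (cong suc rS) (sym rT) , x∉))
    go S (no x∉) (no ns) (yes (fS , ST , e , _)) = ⊥-elim (ns ((R≡suc⇒∅⊂ rS' , fS , rS') , ST))
      where rS' = ℕP.suc-injective (trans e rT)
    go S (no x∉) (no ns) (no _) = z3 (signedμ S) p (μ S)

  reducedCoeff : ℕ → ℤ
  reducedCoeff lo = (-1ℤ ^ suc lo) * (- Σupto lo whitney)

  weightExtSum-[]-inSpan : ∀ lo → (d : Dec (suc lo ≡ hi)) → InSpan ∅ [] (λ x → ΣSub m (λ S → ⟦ covers? lo ∅ S ×-dec d ⟧ * (signedμ S * eS S x)))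
  weightExtSum-[]-inSpan lo (no ne) = 0ℤ , (λ ()) , 0ℤ , λ x →
    trans (ΣSub-0 m (λ S → ind-mul-no (covers? lo ∅ S ×-dec no ne) (signedμ S * eS S x) (λ q → ne (proj₂ q)))) (z0 (eS ∅ x))
    where z0 : ∀ e → 0ℤ ≡ 0ℤ * e + 0ℤ + 0ℤ
          z0 = solve-∀
  weightExtSum-[]-inSpan lo (yes e) = 0ℤ , (λ ()) , reducedCoeff lo , λ x → begin
      ΣSub m (λ S → ⟦ covers? lo ∅ S ×-dec yes e ⟧ * (signedμ S * eS S x))
    ≡⟨ ΣSub-cong m (λ S → go S x (covers? lo ∅ S) (flat? S ×-dec R S ℕP.≟ suc lo)) ⟩
      ΣSub m (λ S → p * (⟦ flat? S ×-dec R S ℕP.≟ suc lo ⟧ * (μ S * eS S x)))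
    ≡⟨ ΣSub-* m p _ ⟩
      p * whitneyWith x (suc lo)
    ≡⟨ cong (p *_) (whitneyWith≡-Σwhitney x lo) ⟩
      reducedCoeff lo
    ≡⟨ z0 (reducedCoeff lo) (eS ∅ x) ⟩
      0ℤ * eS ∅ x + 0ℤ + reducedCoeff lo ∎
    where
    p = -1ℤ ^ suc lo
    z0 : ∀ k e → k ≡ 0ℤ * e + 0ℤ + k
    z0 = solve-∀
    z1 : ∀ p u e → 1ℤ * ((p * u) * e) ≡ p * (1ℤ * (u * e))
    z1 = solve-∀
    z2 : ∀ p u e → 0ℤ ≡ p * (0ℤ * (u * e))
    z2 = solve-∀
    go : ∀ S x → (d1 : Dec (Covers lo ∅ S)) → (d2 : Dec (Flat S × R S ≡ suc lo)) →
         ⟦ d1 ×-dec yes e ⟧ * (signedμ S * eS S x) ≡ p * (⟦ d2 ⟧ * (μ S * eS S x))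
    go S x (yes (_ , fS , rS)) (yes _) rewrite rS = z1 p (μ S) (eS S x)
    go S x (yes (_ , fS , rS)) (no n) = ⊥-elim (n (fS , rS))
    go S x (no n) (yes (fS , rS)) = ⊥-elim (n (R≡suc⇒∅⊂ rS , fS , rS))
    go S x (no n) (no _) = trans (ℤP.*-zeroˡ (signedμ S * eS S x)) (z2 p (μ S) (eS S x))

  coverSum-signed-inSpan : ∀ lo T τ → (d : Dec (SkipFlag lo hi T τ)) → Σ ℤ λ cA → ∀ x → ⟦ d ⟧ * coverSum lo ∅ T (λ S → signedμ S * eS S x) ≡ cA * eS T x
  coverSum-signed-inSpan lo T τ (no _) = 0ℤ , λ x → trans (ℤP.*-zeroˡ (coverSum lo ∅ T (λ S → signedμ S * eS S x))) (sym (ℤP.*-zeroˡ (eS T x)))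
  coverSum-signed-inSpan lo T τ (yes (fT , rT , _)) = coverSum lo ∅ T signedμ - signedμ T , val
    where
    val : ∀ x → 1ℤ * coverSum lo ∅ T (λ S → signedμ S * eS S x) ≡ (coverSum lo ∅ T signedμ - signedμ T) * eS T x
    val x with x ∈? T
    ... | yes x∈T = begin
        1ℤ * coverSum lo ∅ T (λ S → signedμ S * eS S x)
      ≡⟨ ℤP.*-identityˡ _ ⟩
        coverSum lo ∅ T (λ S → signedμ S * eS S x)
      ≡⟨ ΣSub-cong m (λ S → pw ⟦ covers? lo ∅ S ×-dec S ⊂? T ⟧ (signedμ S) (eS S x)) ⟩
        ΣSub m (λ S → ⟦ covers? lo ∅ S ×-dec S ⊂? T ⟧ * signedμ S - ⟦ covers? lo ∅ S ×-dec S ⊂? T ⟧ * (signedμ S * (1ℤ - eS S x)))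
      ≡⟨ ΣSub-- m _ _ ⟩
        coverSum lo ∅ T signedμ - coverSum lo ∅ T (λ S → signedμ S * (1ℤ - eS S x))
      ≡⟨ cong (λ z → coverSum lo ∅ T signedμ - z) (coverSum-missing lo T x fT rT x∈T) ⟩
        coverSum lo ∅ T signedμ - signedμ T
      ≡⟨ sym (trans (cong ((coverSum lo ∅ T signedμ - signedμ T) *_) (eS-in x∈T)) (ℤP.*-identityʳ _)) ⟩
        (coverSum lo ∅ T signedμ - signedμ T) * eS T x ∎
      where
      pw : ∀ i w e → i * (w * e) ≡ i * w - i * (w * (1ℤ - e))
      pw = solve-∀
    ... | no x∉T = trans (ℤP.*-identityˡ (coverSum lo ∅ T (λ S → signedμ S * eS S x))) (trans (ΣSub-0 m pw) (sym (trans (cong ((coverSum lo ∅ T signedμ - signedμ T) *_) (eS-out x∉T)) (ℤP.*-zeroʳ (coverSum lo ∅ T signedμ - signedμ T)))))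
      where
      pw : ∀ S → ⟦ covers? lo ∅ S ×-dec S ⊂? T ⟧ * (signedμ S * eS S x) ≡ 0ℤ
      pw S with covers? lo ∅ S ×-dec S ⊂? T
      ... | no _ = ℤP.*-zeroˡ (signedμ S * eS S x)
      ... | yes (_ , ST) = trans (ℤP.*-identityˡ _) (trans (cong (signedμ S *_) (eS-out (λ x∈S → x∉T (proj₁ ST x∈S)))) (ℤP.*-zeroʳ (signedμ S)))

  flagExtSum-signed-inSpan : ∀ lo T τ → (d : Dec (Covers lo ∅ T)) → Σ ℤ λ d' → Σ (Fin (length τ) → ℤ) λ c' → Σ ℤ λ t' → ∀ x →
         ⟦ d ⟧ * (signedμ T * flagExtSum (suc lo) T τ (λ S → eS S x)) ≡ d' * eS T x + ΣFin (length τ) (λ i → c' i * eS (L.lookup τ i) x) + t'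
  flagExtSum-signed-inSpan lo T τ (yes (_ , fT , rT)) with flagExtSum-inSpan τ (suc lo) T fT rT
  ... | d , c , t , h = signedμ T * d , (λ i → signedμ T * c i) , signedμ T * t , λ x → begin
      1ℤ * (signedμ T * flagExtSum (suc lo) T τ (λ S → eS S x))
    ≡⟨ cong (λ z → 1ℤ * (signedμ T * z)) (h x) ⟩
      1ℤ * (signedμ T * (d * eS T x + ΣFin (length τ) (λ i → c i * eS (L.lookup τ i) x) + t))
    ≡⟨ z1 (signedμ T) d (eS T x) (ΣFin (length τ) (λ i → c i * eS (L.lookup τ i) x)) t ⟩
      signedμ T * d * eS T x + signedμ T * ΣFin (length τ) (λ i → c i * eS (L.lookup τ i) x) + signedμ T * t
    ≡⟨ cong (λ z → signedμ T * d * eS T x + z + signedμ T * t)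
         (trans (sym (ΣFin-* (length τ) (signedμ T) (λ i → c i * eS (L.lookup τ i) x)))
                (Σlist-cong (allFin (length τ)) (λ i → sym (ℤP.*-assoc (signedμ T) (c i) (eS (L.lookup τ i) x))))) ⟩
      signedμ T * d * eS T x + ΣFin (length τ) (λ i → signedμ T * c i * eS (L.lookup τ i) x) + signedμ T * t ∎
    where
    z1 : ∀ w d e S t → 1ℤ * (w * (d * e + S + t)) ≡ w * d * e + w * S + w * t
    z1 = solve-∀
  flagExtSum-signed-inSpan lo T τ (no _) = 0ℤ , (λ _ → 0ℤ) , 0ℤ , λ x → trans (ℤP.*-zeroˡ (signedμ T * flagExtSum (suc lo) T τ (λ S → eS S x)))
    (sym (trans (cong (λ z → 0ℤ * eS T x + z + 0ℤ) (ΣFin-0 (length τ) (λ i → 0ℤ * eS (L.lookup τ i) x) (λ i → ℤP.*-zeroˡ (eS (L.lookup τ i) x))))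
                (z0 (eS T x))))
    where z0 : ∀ e → 0ℤ * e + 0ℤ + 0ℤ ≡ 0ℤ
          z0 = solve-∀

  weightExtSum-inSpan : ∀ τ lo → InSpan ∅ τ (λ x → weightExtSum lo τ (λ S → eS S x))
  weightExtSum-inSpan [] lo with weightExtSum-[]-inSpan lo (suc lo ℕP.≟ hi)
  ... | d , c , t , h = d , c , t , λ x → trans (weightExtSum-[] lo (λ S → eS S x)) (h x)
  weightExtSum-inSpan (T ∷ τ) lo with coverSum-signed-inSpan lo T τ (skipFlag? lo hi T τ) | flagExtSum-signed-inSpan lo T τ (covers? lo ∅ T)
  ... | cA , hA | d' , c' , t' , hB = 0ℤ , c , t' , λ x → begin
      weightExtSum lo (T ∷ τ) (λ S → eS S x)
    ≡⟨ weightExtSum-∷ lo T τ (λ S → eS S x) ⟩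
      ⟦ skipFlag? lo hi T τ ⟧ * coverSum lo ∅ T (λ S → signedμ S * eS S x) + ⟦ covers? lo ∅ T ⟧ * (signedμ T * flagExtSum (suc lo) T τ (λ S → eS S x))
    ≡⟨ cong₂ _+_ (hA x) (hB x) ⟩
      cA * eS T x + (d' * eS T x + ΣFin (length τ) (λ i → c' i * eS (L.lookup τ i) x) + t')
    ≡⟨ comb cA (eS T x) d' (ΣFin (length τ) (λ i → c' i * eS (L.lookup τ i) x)) t' (eS ∅ x) ⟩
      0ℤ * eS ∅ x + ((cA + d') * eS T x + ΣFin (length τ) (λ i → c' i * eS (L.lookup τ i) x)) + t'
    ≡⟨ cong (λ z → 0ℤ * eS ∅ x + z + t') (sym (ΣFin-suc (length τ) (λ i → c i * eS (L.lookup (T ∷ τ) i) x))) ⟩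
      0ℤ * eS ∅ x + ΣFin (length (T ∷ τ)) (λ i → c i * eS (L.lookup (T ∷ τ) i) x) + t' ∎
    where
    comb : ∀ cA eT d' S t' e0 → cA * eT + (d' * eT + S + t') ≡ 0ℤ * e0 + ((cA + d') * eT + S) + t'
    comb = solve-∀
    c : Fin (suc (length τ)) → ℤ
    c zero = cA + d'
    c (suc i) = c' i

  flagExtSum-[]-outside : ∀ lo L → Flat L → R L ≡ lo → 1 ≤ hi → ∀ x → x ∉ L → (d : Dec (suc lo ≡ hi)) →
    ΣSub m (λ S → ⟦ covers? lo L S ×-dec d ⟧ * eS S x) ≡ ⟦ lo ℕP.≟ hi ∸ 1 ⟧
  flagExtSum-[]-outside lo L fl rl h1 x x∉ d = trans (ΣSub-single m _ S0 others) (trans (cong (⟦ covers? lo L S0 ×-dec d ⟧ *_) (eS-in ∈-cover))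
       (trans (ℤP.*-identityʳ _) (⟦⟧-iff (covers? lo L S0 ×-dec d) (lo ℕP.≟ hi ∸ 1) to from)))
    where
    S0 = cl (L ∪ ⁅ x ⁆)
    others : ∀ S → ¬ (S ≡ S0) → ⟦ covers? lo L S ×-dec d ⟧ * eS S x ≡ 0ℤ
    others S ne with covers? lo L S ×-dec d
    ... | no _ = ℤP.*-zeroˡ (eS S x)
    ... | yes (st , _) with x ∈? S
    ...   | yes x∈S = ⊥-elim (ne (covers-unique fl rl x∉ st x∈S))
    ...   | no x∉S = trans (ℤP.*-identityˡ (eS S x)) (eS-out x∉S)
    to : _ → _
    to (_ , e) = cong (_∸ 1) e
    from : _ → _
    from e = cover-covers fl rl x∉ , trans (cong suc e) (trans (ℕP.+-comm 1 (hi ∸ 1)) (ℕP.m∸n+n≡m h1))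

  coverSum-outside : ∀ lo L T (ψ : Subset m → ℤ) x → x ∉ T → coverSum lo L T (λ S → ψ S * eS S x) ≡ 0ℤ
  coverSum-outside lo L T ψ x x∉T = ΣSub-0 m pw
    where
    pw : ∀ S → ⟦ covers? lo L S ×-dec S ⊂? T ⟧ * (ψ S * eS S x) ≡ 0ℤ
    pw S with covers? lo L S ×-dec S ⊂? T
    ... | no _ = ℤP.*-zeroˡ (ψ S * eS S x)
    ... | yes (_ , ST) = trans (ℤP.*-identityˡ _) (trans (cong (ψ S *_) (eS-out (λ x∈S → x∉T (proj₁ ST x∈S)))) (ℤP.*-zeroʳ (ψ S)))

  flagExtSum-outside : ∀ τ lo L → Flat L → R L ≡ lo → 1 ≤ hi → ∀ x → x ∉ L → (∀ {G} → G LM.∈ τ → x ∉ G) →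
    flagExtSum lo L τ (λ S → eS S x) ≡ ⟦ flag? lo (hi ∸ 1) L τ ⟧
  flagExtSum-outside [] lo L fl rl h1 x x∉ _ = flagExtSum-[]-outside lo L fl rl h1 x x∉ (suc lo ℕP.≟ hi)
  flagExtSum-outside (T ∷ τ) lo L fl rl h1 x x∉ all∉ = begin
      flagExtSum lo L (T ∷ τ) (λ S → eS S x)
    ≡⟨ flagExtSum-∷ lo L T τ (λ S → eS S x) ⟩
      ⟦ skipFlag? lo hi T τ ⟧ * coverSum lo L T (λ S → eS S x) + ⟦ covers? lo L T ⟧ * flagExtSum (suc lo) T τ (λ S → eS S x)
    ≡⟨ cong₂ _+_ (trans (cong (⟦ skipFlag? lo hi T τ ⟧ *_) (trans (ΣSub-cong m (λ S → cong (⟦ covers? lo L S ×-dec S ⊂? T ⟧ *_) (sym (ℤP.*-identityˡ (eS S x)))))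
                    (coverSum-outside lo L T (λ _ → 1ℤ) x (all∉ (here refl))))) (ℤP.*-zeroʳ ⟦ skipFlag? lo hi T τ ⟧))
                 (go (covers? lo L T)) ⟩
      0ℤ + ⟦ covers? lo L T ⟧ * ⟦ flag? (suc lo) (hi ∸ 1) T τ ⟧
    ≡⟨ trans (ℤP.+-identityˡ _) (sym (⟦⟧-× (covers? lo L T) (flag? (suc lo) (hi ∸ 1) T τ))) ⟩
      ⟦ flag? lo (hi ∸ 1) L (T ∷ τ) ⟧ ∎
    where
    go : (d : Dec (Covers lo L T)) → ⟦ d ⟧ * flagExtSum (suc lo) T τ (λ S → eS S x) ≡ ⟦ d ⟧ * ⟦ flag? (suc lo) (hi ∸ 1) T τ ⟧
    go (yes (_ , fT , rT)) = cong (1ℤ *_) (flagExtSum-outside τ (suc lo) T fT rT h1 x (all∉ (here refl)) (λ i → all∉ (there i)))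
    go (no _) = trans (ℤP.*-zeroˡ (flagExtSum (suc lo) T τ (λ S → eS S x))) (sym (ℤP.*-zeroˡ ⟦ flag? (suc lo) (hi ∸ 1) T τ ⟧))

  weightExtSum-outside : ∀ T τ lo → 1 ≤ hi → ∀ x → (∀ {G} → G LM.∈ (T ∷ τ) → x ∉ G) →
    weightExtSum lo (T ∷ τ) (λ S → eS S x) ≡ ⟦ flag? lo (hi ∸ 1) ∅ (T ∷ τ) ⟧ * signedμ T
  weightExtSum-outside T τ lo h1 x all∉ = begin
      weightExtSum lo (T ∷ τ) (λ S → eS S x)
    ≡⟨ weightExtSum-∷ lo T τ (λ S → eS S x) ⟩
      ⟦ skipFlag? lo hi T τ ⟧ * coverSum lo ∅ T (λ S → signedμ S * eS S x) + ⟦ covers? lo ∅ T ⟧ * (signedμ T * flagExtSum (suc lo) T τ (λ S → eS S x))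
    ≡⟨ cong₂ _+_ (trans (cong (⟦ skipFlag? lo hi T τ ⟧ *_) (coverSum-outside lo ∅ T signedμ x (all∉ (here refl)))) (ℤP.*-zeroʳ ⟦ skipFlag? lo hi T τ ⟧))
                 (go (covers? lo ∅ T)) ⟩
      0ℤ + ⟦ covers? lo ∅ T ⟧ * ⟦ flag? (suc lo) (hi ∸ 1) T τ ⟧ * signedμ T
    ≡⟨ trans (ℤP.+-identityˡ _) (cong (_* signedμ T) (sym (⟦⟧-× (covers? lo ∅ T) (flag? (suc lo) (hi ∸ 1) T τ)))) ⟩
      ⟦ flag? lo (hi ∸ 1) ∅ (T ∷ τ) ⟧ * signedμ T ∎
    where
    z : ∀ d w g → d * (w * g) ≡ d * g * w
    z = solve-∀
    go : (d : Dec (Covers lo ∅ T)) → ⟦ d ⟧ * (signedμ T * flagExtSum (suc lo) T τ (λ S → eS S x)) ≡ ⟦ d ⟧ * ⟦ flag? (suc lo) (hi ∸ 1) T τ ⟧ * signedμ T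
    go (yes (_ , fT , rT)) = trans (cong (λ z → 1ℤ * (signedμ T * z)) (flagExtSum-outside τ (suc lo) T fT rT h1 x (all∉ (here refl)) (λ i → all∉ (there i))))
                                  (z 1ℤ (signedμ T) ⟦ flag? (suc lo) (hi ∸ 1) T τ ⟧)
    go (no _) = trans (ℤP.*-zeroˡ (signedμ T * flagExtSum (suc lo) T τ (λ S → eS S x))) (sym (trans (cong (_* signedμ T) (ℤP.*-zeroˡ ⟦ flag? (suc lo) (hi ∸ 1) T τ ⟧)) (ℤP.*-zeroˡ (signedμ T))))

  weightExtSum-inside : ∀ T τ lo x → x ∈ T →
    weightExtSum lo (T ∷ τ) (λ S → 1ℤ - eS S x) ≡ ⟦ flag? (suc lo) hi ∅ (T ∷ τ) ⟧ * signedμ T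
  weightExtSum-inside T τ lo x x∈T = begin
      weightExtSum lo (T ∷ τ) (λ S → 1ℤ - eS S x)
    ≡⟨ weightExtSum-∷ lo T τ (λ S → 1ℤ - eS S x) ⟩
      ⟦ skipFlag? lo hi T τ ⟧ * coverSum lo ∅ T (λ S → signedμ S * (1ℤ - eS S x)) + ⟦ covers? lo ∅ T ⟧ * (signedμ T * flagExtSum (suc lo) T τ (λ S → 1ℤ - eS S x))
    ≡⟨ cong₂ _+_ (go (skipFlag? lo hi T τ)) (trans (cong (λ z → ⟦ covers? lo ∅ T ⟧ * (signedμ T * z)) Qz) (z0 ⟦ covers? lo ∅ T ⟧ (signedμ T))) ⟩
      ⟦ skipFlag? lo hi T τ ⟧ * signedμ T + 0ℤ
    ≡⟨ trans (ℤP.+-identityʳ _) (cong (_* signedμ T) (⟦⟧-iff (skipFlag? lo hi T τ) (flag? (suc lo) hi ∅ (T ∷ τ)) to from)) ⟩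
      ⟦ flag? (suc lo) hi ∅ (T ∷ τ) ⟧ * signedμ T ∎
    where
    z0 : ∀ d w → d * (w * 0ℤ) ≡ 0ℤ
    z0 = solve-∀
    go : (d : Dec (SkipFlag lo hi T τ)) → ⟦ d ⟧ * coverSum lo ∅ T (λ S → signedμ S * (1ℤ - eS S x)) ≡ ⟦ d ⟧ * signedμ T
    go (yes (fT , rT , _)) = cong (1ℤ *_) (coverSum-missing lo T x fT rT x∈T)
    go (no _) = trans (ℤP.*-zeroˡ (coverSum lo ∅ T (λ S → signedμ S * (1ℤ - eS S x)))) (sym (ℤP.*-zeroˡ (signedμ T)))
    Qz : flagExtSum (suc lo) T τ (λ S → 1ℤ - eS S x) ≡ 0ℤ
    Qz = ΣSub-0 m pw
      where
      pw : ∀ S → ⟦ flag? (suc lo) hi T (insertS S τ) ⟧ * (1ℤ - eS S x) ≡ 0ℤ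
      pw S with flag? (suc lo) hi T (insertS S τ)
      ... | no _ = ℤP.*-zeroˡ (1ℤ - eS S x)
      ... | yes g = trans (ℤP.*-identityˡ _) (trans (cong (λ z → 1ℤ - z) (eS-in (proj₁ (Flag-above (insertS S τ) g (ins-mem S τ)) x∈T))) refl)
    to : _ → _
    to (fT , rT , g) = (R≡suc⇒∅⊂ rT , fT , rT) , g
    from : _ → _
    from ((_ , fT , rT) , g) = fT , rT , g

module Steps {n : ℕ} (M : Matroid (suc n)) (simple : Simple M) (μ : Subset (suc n) → ℤ) (mob : IsMobius M μ)
             (r : ℕ) (rkF : rk M Full ≡ suc r) where
  m = suc n
  open Closure M
  open Flags M μ

  HasFlagWeights : ℕ → ℕ → Weight m → Set
  HasFlagWeights lo hi w = ∀ σ → T (isChain σ) → w σ ≡ flagWeight lo hi σ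

  module AtTop (hi : ℕ) (hr : hi ≤ r) where
    open ExtSums M μ hi
    open TopWeights M simple μ mob hi

    wExt-flagWeight : ∀ lo (w : Weight m) → HasFlagWeights lo hi w → ∀ τ S → wExt w τ S ≡ flagWeight lo hi (insertS S τ)
    wExt-flagWeight lo w H τ S with if-cases (isChain (insertS S τ)) (w (insertS S τ))
    ... | inj₁ (ch , e) = trans e (H _ ch)
    ... | inj₂ (nch , e) = trans e (sym (go (flag? lo hi ∅ (insertS S τ))))
      where go : (d : Dec (Flag lo hi ∅ (insertS S τ))) → ⟦ d ⟧ * headSignedμ (insertS S τ) ≡ 0ℤ
            go (yes g) = ⊥-elim (nch (Flag⇒isChain r rkF hr (insertS S τ) g))
            go (no _) = ℤP.*-zeroˡ (headSignedμ (insertS S τ))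

    balSum-weightExtSum : ∀ lo (w : Weight m) → HasFlagWeights lo hi w → ∀ τ x → balSum w τ x ≡ weightExtSum lo τ (λ S → eS S x)
    balSum-weightExtSum lo w H τ x = ΣSub-cong m (λ S → cong (_* eS S x) (wExt-flagWeight lo w H τ S))

    wExtSum-weightExtSum : ∀ lo (w : Weight m) → HasFlagWeights lo hi w → ∀ τ x → ΣSub m (λ S → wExt w τ S * (1ℤ - eS S x)) ≡ weightExtSum lo τ (λ S → 1ℤ - eS S x)
    wExtSum-weightExtSum lo w H τ x = ΣSub-cong m (λ S → cong (_* (1ℤ - eS S x)) (wExt-flagWeight lo w H τ S))

    balSum-inSpan : ∀ lo (w : Weight m) → HasFlagWeights lo hi w → ∀ τ → Σ (Fin (length τ) → ℤ) λ c → Σ ℤ λ t →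
      ∀ x → balSum w τ x ≡ ΣFin (length τ) (λ i → c i * eS (L.lookup τ i) x) + t
    balSum-inSpan lo w H τ with weightExtSum-inSpan τ lo
    ... | d , c , t , h = c , t , λ x → trans (balSum-weightExtSum lo w H τ x) (trans (h x)
          (trans (cong (λ z → d * z + ΣFin (length τ) (λ i → c i * eS (L.lookup τ i) x) + t) (eS-out {S = ∅} {x} ∉⊥))
                 (lem d (ΣFin (length τ) (λ i → c i * eS (L.lookup τ i) x)) t)))
      where lem : ∀ d s t → d * 0ℤ + s + t ≡ s + t
            lem = solve-∀

    weightExtSum-[]-below : ∀ lo ψ → ¬ (suc lo ≡ hi) → weightExtSum lo [] ψ ≡ 0ℤ
    weightExtSum-[]-below lo ψ ne = trans (weightExtSum-[] lo ψ) (ΣSub-0 m (λ S → ind-mul-no (covers? lo ∅ S ×-dec suc lo ℕP.≟ hi) (signedμ S * ψ S) (λ p → ne (proj₂ p))))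

    α-lowersTop : ∀ lo → suc lo < hi → (w w' : Weight m) → HasFlagWeights lo hi w → IsProduct α w w' → HasFlagWeights lo (hi ∸ 1) w'
    α-lowersTop lo lt w w' hyp prod [] ch = trans e1 (trans e2 (trans e3 e4))
      where
      D = balSum-inSpan lo w hyp []
      e1 : w' [] ≡ balSum w [] zero
      e1 = product-α w w' prod [] ch (proj₁ D) (proj₁ (proj₂ D)) (proj₂ (proj₂ D)) zero (λ ())
      e2 : balSum w [] zero ≡ weightExtSum lo [] (λ S → eS S zero)
      e2 = balSum-weightExtSum lo w hyp [] zero
      e3 : weightExtSum lo [] (λ S → eS S zero) ≡ 0ℤ
      e3 = weightExtSum-[]-below lo (λ S → eS S zero) (λ e → ℕP.<-irrefl e lt)
      e4 : 0ℤ ≡ flagWeight lo (hi ∸ 1) []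
      e4 = sym (ℤP.*-zeroʳ ⟦ flag? lo (hi ∸ 1) ∅ [] ⟧)
    α-lowersTop lo lt w w' hyp prod (T ∷ τ) ch = trans e1 (trans e2 e3)
      where
      D = balSum-inSpan lo w hyp (T ∷ τ)
      W = nonemptyProper-witnesses (lastOf T τ) (chain-np (T ∷ τ) ch (lastOf-mem T τ))
      y : Fin m
      y = proj₁ (proj₂ W)
      y∉ : y ∉ lastOf T τ
      y∉ = proj₂ (proj₂ W)
      out : ∀ {G} → G LM.∈ (T ∷ τ) → y ∉ G
      out G∈ y∈G = y∉ (chain-last T τ ch G∈ y∈G)
      e1 : w' (T ∷ τ) ≡ balSum w (T ∷ τ) y
      e1 = product-α w w' prod (T ∷ τ) ch (proj₁ D) (proj₁ (proj₂ D)) (proj₂ (proj₂ D)) y out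
      e2 : balSum w (T ∷ τ) y ≡ weightExtSum lo (T ∷ τ) (λ S → eS S y)
      e2 = balSum-weightExtSum lo w hyp (T ∷ τ) y
      e3 : weightExtSum lo (T ∷ τ) (λ S → eS S y) ≡ flagWeight lo (hi ∸ 1) (T ∷ τ)
      e3 = weightExtSum-outside T τ lo (ℕP.≤-trans (s≤s z≤n) lt) y out

    cremα-raisesBottom : ∀ lo → suc lo < hi → (w w' : Weight m) → HasFlagWeights lo hi w → IsProduct cremα w w' → HasFlagWeights (suc lo) hi w'
    cremα-raisesBottom lo lt w w' hyp prod [] ch = trans e1 (trans e2 (trans e3 e4))
      where
      D = balSum-inSpan lo w hyp []
      e1 : w' [] ≡ ΣSub m (λ S → wExt w [] S * (1ℤ - eS S zero))
      e1 = product-cremα w w' prod [] ch (proj₁ D) (proj₁ (proj₂ D)) (proj₂ (proj₂ D)) zero (λ ())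
      e2 : ΣSub m (λ S → wExt w [] S * (1ℤ - eS S zero)) ≡ weightExtSum lo [] (λ S → 1ℤ - eS S zero)
      e2 = wExtSum-weightExtSum lo w hyp [] zero
      e3 : weightExtSum lo [] (λ S → 1ℤ - eS S zero) ≡ 0ℤ
      e3 = weightExtSum-[]-below lo (λ S → 1ℤ - eS S zero) (λ e → ℕP.<-irrefl e lt)
      e4 : 0ℤ ≡ flagWeight (suc lo) hi []
      e4 = sym (ℤP.*-zeroʳ ⟦ flag? (suc lo) hi ∅ [] ⟧)
    cremα-raisesBottom lo lt w w' hyp prod (T ∷ τ) ch = trans e1 (trans e2 e3)
      where
      D = balSum-inSpan lo w hyp (T ∷ τ)
      W = nonemptyProper-witnesses T (chain-np (T ∷ τ) ch (here refl))
      y : Fin m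
      y = proj₁ (proj₁ W)
      y∈ : y ∈ T
      y∈ = proj₂ (proj₁ W)
      inn : ∀ {G} → G LM.∈ (T ∷ τ) → y ∈ G
      inn G∈ = chain-head T τ ch G∈ y∈
      e1 : w' (T ∷ τ) ≡ ΣSub m (λ S → wExt w (T ∷ τ) S * (1ℤ - eS S y))
      e1 = product-cremα w w' prod (T ∷ τ) ch (proj₁ D) (proj₁ (proj₂ D)) (proj₂ (proj₂ D)) y inn
      e2 : ΣSub m (λ S → wExt w (T ∷ τ) S * (1ℤ - eS S y)) ≡ weightExtSum lo (T ∷ τ) (λ S → 1ℤ - eS S y)
      e2 = wExtSum-weightExtSum lo w hyp (T ∷ τ) y
      e3 : weightExtSum lo (T ∷ τ) (λ S → 1ℤ - eS S y) ≡ flagWeight (suc lo) hi (T ∷ τ)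
      e3 = weightExtSum-inside T τ lo y y∈

    weightExtSum-[]-top : ∀ lo → suc lo ≡ hi → ∀ x → weightExtSum lo [] (λ S → eS S x) ≡ reducedCoeff lo
    weightExtSum-[]-top lo e x = trans (weightExtSum-[] lo (λ S → eS S x)) (go (suc lo ℕP.≟ hi))
      where
      go : (d : Dec (suc lo ≡ hi)) → ΣSub m (λ S → ⟦ covers? lo ∅ S ×-dec d ⟧ * (signedμ S * eS S x)) ≡ reducedCoeff lo
      go (no ne) = ⊥-elim (ne e)
      go (yes e') = trans (proj₂ (proj₂ (proj₂ (weightExtSum-[]-inSpan lo (yes e')))) x)
        (trans (cong (λ z → 0ℤ * z + 0ℤ + reducedCoeff lo) (eS-out {S = ∅} {x} ∉⊥)) (lem (reducedCoeff lo)))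
        where lem : ∀ k → 0ℤ * 0ℤ + 0ℤ + k ≡ k
              lem = solve-∀

    α-last : ∀ lo → suc lo ≡ hi → (w w' : Weight m) → HasFlagWeights lo hi w → IsProduct α w w' → w' [] ≡ reducedCoeff lo
    α-last lo e w w' hyp prod = trans e1 (trans e2 e3)
      where
      D = balSum-inSpan lo w hyp []
      e1 : w' [] ≡ balSum w [] zero
      e1 = product-α w w' prod [] tt (proj₁ D) (proj₁ (proj₂ D)) (proj₂ (proj₂ D)) zero (λ ())
      e2 : balSum w [] zero ≡ weightExtSum lo [] (λ S → eS S zero)
      e2 = balSum-weightExtSum lo w hyp [] zero
      e3 : weightExtSum lo [] (λ S → eS S zero) ≡ reducedCoeff lo
      e3 = weightExtSum-[]-top lo e zero

    Full-flat : Flat Full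
    Full-flat = flat-in (λ x x∉ → ⊥-elim (x∉ ∈⊤))

    cremα-last : ∀ lo → suc lo ≡ hi → hi ≡ r → (w w' : Weight m) → HasFlagWeights lo hi w → IsProduct cremα w w' → w' [] ≡ signedμ Full
    cremα-last lo e hr' w w' hyp prod = trans e1 (trans e2 (trans e3 (trans e4 e5)))
      where
      D = balSum-inSpan lo w hyp []
      e1 : w' [] ≡ ΣSub m (λ S → wExt w [] S * (1ℤ - eS S zero))
      e1 = product-cremα w w' prod [] tt (proj₁ D) (proj₁ (proj₂ D)) (proj₂ (proj₂ D)) zero (λ ())
      e2 : ΣSub m (λ S → wExt w [] S * (1ℤ - eS S zero)) ≡ weightExtSum lo [] (λ S → 1ℤ - eS S zero)
      e2 = wExtSum-weightExtSum lo w hyp [] zero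
      e3 : weightExtSum lo [] (λ S → 1ℤ - eS S zero) ≡ ΣSub m (λ S → ⟦ covers? lo ∅ S ×-dec suc lo ℕP.≟ hi ⟧ * (signedμ S * (1ℤ - eS S zero)))
      e3 = weightExtSum-[] lo (λ S → 1ℤ - eS S zero)
      to : ∀ {S} → Covers lo ∅ S × suc lo ≡ hi → Covers lo ∅ S × S ⊂ Full
      to {S} (st@(_ , _ , rS) , _) = st , ⊆∧⊉⇒⊂ (λ _ → ∈⊤) (λ FS → ℕP.<-irrefl refl (ℕP.<-≤-trans
          (ℕP.≤-reflexive (trans (cong suc (trans rS (trans e hr'))) (sym rkF))) (R-mono FS)))
      from : ∀ {S} → Covers lo ∅ S × S ⊂ Full → Covers lo ∅ S × suc lo ≡ hi
      from (st , _) = st , e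
      e4 : ΣSub m (λ S → ⟦ covers? lo ∅ S ×-dec suc lo ℕP.≟ hi ⟧ * (signedμ S * (1ℤ - eS S zero))) ≡ coverSum lo ∅ Full (λ S → signedμ S * (1ℤ - eS S zero))
      e4 = ΣSub-cong m (λ S → cong (_* (signedμ S * (1ℤ - eS S zero))) (⟦⟧-iff (covers? lo ∅ S ×-dec suc lo ℕP.≟ hi) (covers? lo ∅ S ×-dec S ⊂? Full) to from))
      e5 : coverSum lo ∅ Full (λ S → signedμ S * (1ℤ - eS S zero)) ≡ signedμ Full
      e5 = coverSum-missing lo Full zero Full-flat (trans rkF (cong suc (sym (trans e hr')))) ∈⊤

  cremα-iterate : (W : ℕ → Weight m) → HasFlagWeights 0 r (W 0) →
    ∀ k → (∀ i → i < k → IsProduct cremα (W i) (W (suc i))) → ∀ j → j ≤ k → j < r → HasFlagWeights j r (W j)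
  cremα-iterate W W₀ k steps zero _ _ = W₀
  cremα-iterate W W₀ k steps (suc j) j<k j<r = AtTop.cremα-raisesBottom r ℕP.≤-refl j j<r (W j) (W (suc j))
    (cremα-iterate W W₀ k steps j (ℕP.≤-trans (ℕP.n≤1+n j) j<k) (ℕP.<-trans (ℕP.n<1+n j) j<r)) (steps j j<k)

module Characteristic {n : ℕ} (M : Matroid (suc n)) (simple : Simple M) (r : ℕ) (rkF : rank M ≡ suc r)
             (μ : Subset (suc n) → ℤ) (mob : IsMobius M μ) where
  open Closure M
  open Weisner M μ mob
  open Flags M μ
  open Whitney M simple μ mob
  open Steps M simple μ mob r rkF

  χ≡poly : ∀ q → χ M μ q ≡ poly whitney (suc r) q
  χ≡poly q = begin
      χ M μ q
    ≡⟨ ΣSub-cong m pw ⟩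
      ΣSub m (λ F → Σupto (suc r) (λ d → (⟦ flat? F ×-dec R F ℕP.≟ d ⟧ * μ F) * q ^ (suc r ∸ d)))
    ≡⟨ ΣSub-Σupto m (suc r) (λ F d → (⟦ flat? F ×-dec R F ℕP.≟ d ⟧ * μ F) * q ^ (suc r ∸ d)) ⟩
      Σupto (suc r) (λ d → ΣSub m (λ F → (⟦ flat? F ×-dec R F ℕP.≟ d ⟧ * μ F) * q ^ (suc r ∸ d)))
    ≡⟨ Σupto-cong (suc r) _ _ (λ d _ → ΣSub-*ʳ m (λ F → ⟦ flat? F ×-dec R F ℕP.≟ d ⟧ * μ F) (q ^ (suc r ∸ d))) ⟩
      poly whitney (suc r) q ∎
    where
    pw : ∀ F → (if isFlat M F then μ F * q ^ (rank M ∸ rk M F) else 0ℤ) ≡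
               Σupto (suc r) (λ d → (⟦ flat? F ×-dec R F ℕP.≟ d ⟧ * μ F) * q ^ (suc r ∸ d))
    pw F with if-cases (isFlat M F) (μ F * q ^ (rank M ∸ rk M F))
    ... | inj₁ (fl , e) = trans e (trans (cong (λ z → μ F * q ^ (z ∸ R F)) rkF)
          (sym (trans (Σupto-single (suc r) (R F) _ (ℕP.≤-trans (R≤R-Full F) (ℕP.≤-reflexive rkF))
               (λ d _ ne → trans (cong (_* q ^ (suc r ∸ d)) (ind-mul-no (flat? F ×-dec R F ℕP.≟ d) (μ F) (λ p → ne (sym (proj₂ p)))))
                                 (ℤP.*-zeroˡ (q ^ (suc r ∸ d)))))
               (cong (_* q ^ (suc r ∸ R F)) (ind-mul-yes (flat? F ×-dec R F ℕP.≟ R F) (μ F) (fl , refl))))))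
    ... | inj₂ (nfl , e) = trans e (sym (Σupto-0 (suc r) _ (λ d _ →
          trans (cong (_* q ^ (suc r ∸ d)) (ind-mul-no (flat? F ×-dec R F ℕP.≟ d) (μ F) (λ p → nfl (proj₁ p)))) (ℤP.*-zeroˡ (q ^ (suc r ∸ d))))))

  μᵏ≡ : (mu : ℕ → ℤ) → IsReducedCoeffs M μ r mu → ∀ k → k ≤ r → mu k ≡ (-1ℤ ^ k) * Σupto k whitney
  μᵏ≡ mu red k k≤ = trans (sym (lem (-1ℤ ^ k) (mu k) (-1^k*-1^k k))) (cong ((-1ℤ ^ k) *_) (CoeffExtraction.coeff≡partialSum r whitney (λ i → (-1ℤ ^ i) * mu i) hyp k k≤))
    where
    hyp : ∀ q → poly whitney (suc r) q ≡ (q - 1ℤ) * poly (λ i → (-1ℤ ^ i) * mu i) r q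
    hyp q = trans (sym (χ≡poly q)) (red q)
    lem : ∀ p x → p * p ≡ 1ℤ → p * (p * x) ≡ x
    lem p x e = trans (sym (ℤP.*-assoc p p x)) (trans (cong (_* x) e) (ℤP.*-identityˡ x))

  whitneyWith-top : whitneyWith zero (suc r) ≡ μ Full
  whitneyWith-top = trans (ΣSub-single m _ Full others) (trans (ind-mul-yes (flat? Full ×-dec R Full ℕP.≟ suc r) _ (flat-in (λ x x∉ → ⊥-elim (x∉ ∈⊤)) , rkF))
                 (trans (cong (μ Full *_) (eS-in {suc n} {Full} {zero} ∈⊤)) (ℤP.*-identityʳ (μ Full))))
    where
    others : ∀ S → ¬ (S ≡ Full) → ⟦ flat? S ×-dec R S ℕP.≟ suc r ⟧ * (μ S * eS S zero) ≡ 0ℤ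
    others S ne = ind-mul-no (flat? S ×-dec R S ℕP.≟ suc r) _ (λ { (fS , rS) → ne (flat-eq fS (λ _ → ∈⊤) (trans rS (sym rkF))) })

  Flag-length : ∀ {lo hi L} σ → Flag lo hi L σ → lo ℕ.+ length σ ≡ hi
  Flag-length {lo} [] refl = ℕP.+-identityʳ lo
  Flag-length {lo} (G ∷ σ) (_ , g) = trans (ℕP.+-suc lo (length σ)) (Flag-length σ g)

  Flag-flat : ∀ {lo hi L} σ → Flag lo hi L σ → ∀ {G} → G LM.∈ σ → Flat G
  Flag-flat (G ∷ σ) ((_ , fG , _) , g) (here refl) = fG
  Flag-flat (G ∷ σ) (_ , g) (there i) = Flag-flat σ g i

  R-proper : ∀ {G} → Flat G → T (nonemptyProper G) → R G ≤ r
  R-proper {G} fG np with R G ℕP.≤? r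
  ... | yes le = le
  ... | no nle = ⊥-elim (not-does-T (Full ⊆? G) (∧-snd {not (does (G ⊆? ∅))} np)
          (subst (Full ⊆_) (sym (flat-eq fG (λ _ → ∈⊤) (ℕP.≤-antisym (R≤R-Full G) (ℕP.≤-trans (ℕP.≤-reflexive rkF) (ℕP.≰⇒> nle))))) (λ z → z)))

  chain-rankBound : ∀ G σ → T (isChain (G ∷ σ)) → T (allB (isFlat M) (G ∷ σ)) → R G ℕ.+ length σ ≤ r
  chain-rankBound G [] ch fl = ℕP.≤-trans (ℕP.≤-reflexive (ℕP.+-identityʳ (R G))) (R-proper (∧-fst fl) ch)
  chain-rankBound G (H ∷ σ) ch fl = ℕP.≤-trans (ℕP.≤-reflexive (ℕP.+-suc (R G) (length σ)))
    (ℕP.≤-trans (ℕP.+-monoˡ-≤ (length σ) (R-strictMono (∧-fst fl) (chain-⊂ G H σ ch))) (chain-rankBound H σ (chain-tail G H σ ch) (∧-snd {isFlat M G} fl)))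

  Below : Subset m → List (Subset m) → Set
  Below L [] = ⊤
  Below L (G ∷ _) = L ⊂ G

  flatChain⇒Flag : ∀ σ lo L → Flat L → R L ≡ lo → Below L σ → T (isChain σ) → T (allB (isFlat M) σ) → lo ℕ.+ length σ ≡ r → Flag lo r L σ
  flatChain⇒Flag [] lo L fL rL _ _ _ e = trans (sym (ℕP.+-identityʳ lo)) e
  flatChain⇒Flag (G ∷ σ) lo L fL rL LG ch fl e = (LG , fG , rG) , flatChain⇒Flag σ (suc lo) G fG rG (below σ ch) (tailch σ ch) (∧-snd {isFlat M G} fl)
                                        (trans (sym (ℕP.+-suc lo (length σ))) e)
    where
    fG : Flat G
    fG = ∧-fst fl
    lt : lo < R G
    lt = subst (_< R G) rL (R-strictMono fL LG)
    up : R G ℕ.+ length σ ≤ lo ℕ.+ suc (length σ)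
    up = ℕP.≤-trans (chain-rankBound G σ ch fl) (ℕP.≤-reflexive (sym e))
    rG : R G ≡ suc lo
    rG = ℕP.≤-antisym (ℕP.+-cancelʳ-≤ (length σ) (R G) (suc lo) (ℕP.≤-trans up (ℕP.≤-reflexive (ℕP.+-suc lo (length σ))))) lt
    below : ∀ σ → T (isChain (G ∷ σ)) → Below G σ
    below [] _ = _
    below (H ∷ σ) ch = chain-⊂ G H σ ch
    tailch : ∀ σ → T (isChain (G ∷ σ)) → T (isChain σ)
    tailch [] _ = tt
    tailch (H ∷ σ) ch = chain-tail G H σ ch

  nonemptyProper⇒∅⊂ : ∀ {G : Subset (suc n)} → T (nonemptyProper G) → ∅ ⊂ G
  nonemptyProper⇒∅⊂ {G} np = ⊆∧⊉⇒⊂ (λ z → ⊥-elim (∉⊥ z)) (not-does-T (G ⊆? ∅) (∧-fst np))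

  μ-atom : ∀ {G} → Flat G → R G ≡ 1 → μ G ≡ -1ℤ
  μ-atom {G} fG rG = trans (+≡0⇒a≡-b (μ G) _ (weisner x G fG x∈)) (cong -_ sum1)
    where
    ne : ¬ (G ⊆ ∅)
    ne h = ℕP.<-irrefl refl (ℕP.<-≤-trans (ℕP.≤-reflexive (sym rG)) (ℕP.≤-trans (R-mono h) (ℕP.≤-reflexive R-∅)))
    W = ⊈∅-witness G ne
    x = proj₁ W
    x∈ = proj₂ W
    others : ∀ S → ¬ (S ≡ ∅) → ⟦ hyperplaneMissing? x G S ⟧ * μ S ≡ 0ℤ
    others S ne' = ind-mul-no (hyperplaneMissing? x G S) (μ S) (λ { (fS , _ , e , _) → ne' (R≡0⇒≡∅ simple (ℕP.suc-injective (trans e rG))) })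
    sum1 : ΣSub m (λ S → ⟦ hyperplaneMissing? x G S ⟧ * μ S) ≡ 1ℤ
    sum1 = trans (ΣSub-single m _ ∅ others) (trans (ind-mul-yes (hyperplaneMissing? x G ∅) (μ ∅)
             (∅-flat simple , ⊆∧⊉⇒⊂ (λ z → ⊥-elim (∉⊥ z)) (λ h → ∉⊥ (h x∈)) , trans (cong suc R-∅) (sym rG) , ∉⊥))
             (IsMobius.mob-bot mob))

  ΔM-hasFlagWeights : 1 ≤ r → (W0 : Weight m) → (∀ τ → W0 τ ≡ ΔM M r τ) → HasFlagWeights 0 r W0
  ΔM-hasFlagWeights r≥1 W0 hW σ ch = trans (hW σ) (go (if-cases (isChain σ ∧ ((length σ ≡ᵇ r) ∧ allB (isFlat M) σ)) 1ℤ))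
    where
    go : _ → ΔM M r σ ≡ flagWeight 0 r σ
    go (inj₁ (tb , e)) = trans e (sym (trans (cong (_* headSignedμ σ) (⟦⟧-yes (flag? 0 r ∅ σ) g)) (trans (ℤP.*-identityˡ (headSignedμ σ)) (wh σ g))))
      where
      tb2 = ∧-snd {isChain σ} tb
      len : length σ ≡ r
      len = ℕP.≡ᵇ⇒≡ (length σ) r (∧-fst tb2)
      fl = ∧-snd {length σ ≡ᵇ r} tb2
      bel : ∀ σ → length σ ≡ r → T (isChain σ) → Below ∅ σ
      bel [] e _ = ⊥-elim (ℕP.<-irrefl e r≥1)
      bel (G ∷ σ) _ ch = nonemptyProper⇒∅⊂ (chain-np (G ∷ σ) ch (here refl))
      g : Flag 0 r ∅ σ
      g = flatChain⇒Flag σ 0 ∅ (∅-flat simple) R-∅ (bel σ len ch) ch fl len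
      wh : ∀ σ → Flag 0 r ∅ σ → headSignedμ σ ≡ 1ℤ
      wh [] g = ⊥-elim (ℕP.<-irrefl g r≥1)
      wh (G ∷ σ) ((_ , fG , rG) , _) = trans (cong (λ z → (-1ℤ ^ z) * μ G) rG) (cong ((-1ℤ ^ 1) *_) (μ-atom fG rG))
    go (inj₂ (ntb , e)) = trans e (sym (ind-mul-no (flag? 0 r ∅ σ) (headSignedμ σ) (λ g → ntb
         (∧-intro ch (∧-intro (ℕP.≡⇒≡ᵇ (length σ) r (Flag-length σ g)) (allB-mem (isFlat M) σ (Flag-flat σ g)))))))

lemma6p1-below : (n r : ℕ) (M : Matroid (suc n)) → Simple M → rank M ≡ suc r →
    (k : ℕ) → k < r →
    (μ : Subset (suc n) → ℤ) → IsMobius M μ →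
    (mu : ℕ → ℤ) → IsReducedCoeffs M μ r mu →
    (W : ℕ → Weight (suc n)) →
    (∀ τ → W 0 τ ≡ ΔM M r τ) →
    (∀ i → i < k → IsProduct cremα (W i) (W (suc i))) →
    (∀ i → k ≤ i → i < r → IsProduct α (W i) (W (suc i))) →
    W r [] ≡ mu k
lemma6p1-below n (suc r′) M simple rkF k (s≤s k≤r′) μ mob mu reduced W W₀≡ΔM cremSteps αSteps = trans lastStep (sym mu≡)
  where
  r = suc r′
  open Characteristic M simple r rkF μ mob
  open Closure M
  open Whitney M simple μ mob
  open Steps M simple μ mob r rkF
  cremPhase : ∀ j → j ≤ k → j < r → HasFlagWeights j r (W j)
  cremPhase = cremα-iterate W (ΔM-hasFlagWeights (s≤s z≤n) (W 0) W₀≡ΔM) k cremSteps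
  αPhase : ∀ i → k ℕ.+ i < r → HasFlagWeights k (r ∸ i) (W (k ℕ.+ i))
  αPhase zero lt = subst (λ z → HasFlagWeights k r (W z)) (sym (ℕP.+-identityʳ k)) (cremPhase k ℕP.≤-refl (subst (_< r) (ℕP.+-identityʳ k) lt))
  αPhase (suc i) lt = subst₂ (λ a b → HasFlagWeights k a (W b)) (trans (ℕP.∸-+-assoc r i 1) (cong (r ∸_) (ℕP.+-comm i 1))) (sym (ℕP.+-suc k i)) step
    where
    k+i<r : k ℕ.+ i < r
    k+i<r = ℕP.<-trans (subst (k ℕ.+ i <_) (sym (ℕP.+-suc k i)) (ℕP.n<1+n (k ℕ.+ i))) lt
    1+k<r∸i : suc k < r ∸ i
    1+k<r∸i = ℕP.m+n≤o⇒m≤o∸n (suc (suc k)) (subst (_≤ r) (cong suc (ℕP.+-suc k i)) lt)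
    step : HasFlagWeights k ((r ∸ i) ∸ 1) (W (suc (k ℕ.+ i)))
    step = AtTop.α-lowersTop (r ∸ i) (ℕP.m∸n≤m r i) k 1+k<r∸i (W (k ℕ.+ i)) (W (suc (k ℕ.+ i))) (αPhase i k+i<r)
             (αSteps (k ℕ.+ i) (ℕP.m≤m+n k i) k+i<r)
  i₀ = r′ ∸ k
  k+i₀≡r′ : k ℕ.+ i₀ ≡ r′
  k+i₀≡r′ = ℕP.m+[n∸m]≡n k≤r′
  r∸i₀≡1+k : r ∸ i₀ ≡ suc k
  r∸i₀≡1+k = trans (ℕP.+-∸-assoc 1 (ℕP.m∸n≤m r′ k)) (cong suc (ℕP.m∸[m∸n]≡n k≤r′))
  beforeLastα : HasFlagWeights k (suc k) (W r′)
  beforeLastα = subst₂ (λ a b → HasFlagWeights k a (W b)) r∸i₀≡1+k k+i₀≡r′ (αPhase i₀ (subst (_< r) (sym k+i₀≡r′) (ℕP.n<1+n r′)))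
  lastStep : W r [] ≡ (-1ℤ ^ suc k) * (- Σupto k whitney)
  lastStep = AtTop.α-last (suc k) (s≤s k≤r′) k refl (W r′) (W r) beforeLastα (αSteps r′ k≤r′ (ℕP.n<1+n r′))
  mu≡ : mu k ≡ (-1ℤ ^ suc k) * (- Σupto k whitney)
  mu≡ = trans (μᵏ≡ mu reduced k (ℕP.≤-trans k≤r′ (ℕP.n≤1+n r′))) (lem (-1ℤ ^ k) (Σupto k whitney))
    where lem : ∀ p s → p * s ≡ (-1ℤ * p) * (- s)
          lem = solve-∀

lemma6p1-top : (n r : ℕ) (M : Matroid (suc n)) → Simple M → rank M ≡ suc r →
    (μ : Subset (suc n) → ℤ) → IsMobius M μ →
    (mu : ℕ → ℤ) → IsReducedCoeffs M μ r mu →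
    (W : ℕ → Weight (suc n)) →
    (∀ τ → W 0 τ ≡ ΔM M r τ) →
    (∀ i → i < r → IsProduct cremα (W i) (W (suc i))) →
    W r [] ≡ mu r
lemma6p1-top n zero M simple rkF μ mob mu reduced W W₀≡ΔM cremSteps = trans (W₀≡ΔM []) (sym (trans (μᵏ≡ mu reduced 0 z≤n) (trans (ℤP.*-identityˡ (whitney 0)) whitney-0)))
  where
  open Characteristic M simple zero rkF μ mob
  open Closure M
  open Whitney M simple μ mob
  whitney-0 : whitney 0 ≡ 1ℤ
  whitney-0 = trans (ΣSub-single (suc n) _ ∅ (λ F ne → ind-mul-no (flat? F ×-dec R F ℕP.≟ 0) (μ F) (λ { (fF , r0) → ne (R≡0⇒≡∅ simple r0) })))
             (trans (ind-mul-yes (flat? ∅ ×-dec R ∅ ℕP.≟ 0) (μ ∅) (∅-flat simple , R-∅)) (IsMobius.mob-bot mob))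
lemma6p1-top n (suc r′) M simple rkF μ mob mu reduced W W₀≡ΔM cremSteps = trans lastStep (sym mu≡)
  where
  r = suc r′
  open Characteristic M simple r rkF μ mob
  open Closure M
  open Flags M μ
  open Whitney M simple μ mob
  open Steps M simple μ mob r rkF
  beforeLastCremα : HasFlagWeights r′ r (W r′)
  beforeLastCremα = cremα-iterate W (ΔM-hasFlagWeights (s≤s z≤n) (W 0) W₀≡ΔM) r cremSteps r′ (ℕP.n≤1+n r′) ℕP.≤-refl
  lastStep : W r [] ≡ signedμ Full
  lastStep = AtTop.cremα-last r ℕP.≤-refl r′ refl refl (W r′) (W r) beforeLastCremα (cremSteps r′ ℕP.≤-refl)
  Σwhitney≡ : Σupto r whitney ≡ - μ Full
  Σwhitney≡ = trans (sym (ℤP.neg-involutive (Σupto r whitney))) (cong -_ (trans (sym (whitneyWith≡-Σwhitney zero r)) whitneyWith-top))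
  mu≡ : mu r ≡ signedμ Full
  mu≡ = trans (μᵏ≡ mu reduced r ℕP.≤-refl) (trans (cong ((-1ℤ ^ r) *_) Σwhitney≡)
          (trans (lem (-1ℤ ^ r) (μ Full)) (cong (λ z → (-1ℤ ^ z) * μ Full) (sym rkF))))
    where lem : ∀ p u → p * (- u) ≡ (-1ℤ * p) * u
          lem = solve-∀

lemma6p1 : (n r : ℕ) (M : Matroid (suc n)) → Simple M → rank M ≡ suc r →
    (k : ℕ) → k ≤ r →
    (μ : Subset (suc n) → ℤ) → IsMobius M μ →
    (mu : ℕ → ℤ) → IsReducedCoeffs M μ r mu →
    (W : ℕ → Weight (suc n)) →
    (∀ τ → W 0 τ ≡ ΔM M r τ) →
    (∀ i → i < k → IsProduct cremα (W i) (W (suc i))) →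
    (∀ i → k ≤ i → i < r → IsProduct α (W i) (W (suc i))) →
    W r [] ≡ mu k
lemma6p1 n r M simple rkF k k≤r μ mob mu reduced W W₀≡ΔM cremSteps αSteps with ℕP.m≤n⇒m<n∨m≡n k≤r
... | inj₁ k<r = lemma6p1-below n r M simple rkF k k<r μ mob mu reduced W W₀≡ΔM cremSteps αSteps
... | inj₂ refl = lemma6p1-top n k M simple rkF μ mob mu reduced W W₀≡ΔM cremSteps
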